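{- Let $G$ be a finite simple graph such that every connected induced subgraph of $G$ is geodetic (i.e. $G$ belongs to the maximal hereditary subclass $\lfloor\mathcal G\rfloor$ of the class of geodetic graphs). Then every block of $G$ is either a complete graph or a cycle of odd length.
   Context: A geodesic is a shortest path between two vertices; a graph is geodetic if between any two vertices there is exactly one geodesic. The class $\lfloor\mathcal G\rfloor$ is the largest class of graphs closed under taking induced subgraphs all of whose members have only geodetic connected components; equivalently, the graphs all of whose connected induced subgraphs are geodetic. A block is a maximal connected subgraph without a cut vertex. -}

module Defs where

open import Data.Nat using (ℕ; suc; _+_; _*_; _≤_)
open import Data.Nat.DivMod using (_%_)
open import Data.Fin using (Fin; toℕ)
open import Data.Fin.Subset using (Subset; _∈_; _⊆_; _-_)
open import Data.List using (List; length; head; last)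
open import Data.List.Relation.Unary.All using (All)
open import Data.List.Relation.Unary.Linked using (Linked)
open import Data.List.Relation.Unary.Unique.Propositional using (Unique)
open import Data.Maybe using (just)
open import Data.Product using (Σ; ∃; _×_)
open import Data.Sum using (_⊎_)
open import Function.Bundles using (_⇔_)
open import Relation.Binary.PropositionalEquality using (_≡_; _≢_)
open import Relation.Nullary using (¬_; Dec)

record Graph (n : ℕ) : Set₁ where
  field
    Adj    : Fin n → Fin n → Set
    adj?   : (u v : Fin n) → Dec (Adj u v)
    sym    : ∀ {u v} → Adj u v → Adj v u
    irrefl : ∀ {u} → ¬ Adj u u

module _ {n : ℕ} (G : Graph n) where
  open Graph G

  -- Its length (number of edges) is
  -- length p minus 1, so comparing list lengths compares path lengths.
  record IsPath (S : Subset n) (u v : Fin n) (p : List (Fin n)) : Set where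
    field
      start  : head p ≡ just u
      end    : last p ≡ just v
      inS    : All (_∈ S) p
      linked : Linked Adj p
      unique : Unique p

  IsGeodesic : Subset n → Fin n → Fin n → List (Fin n) → Set
  IsGeodesic S u v p =
    IsPath S u v p × (∀ q → IsPath S u v q → length p ≤ length q)

  Connected : Subset n → Set
  Connected S =
    (∃ λ u → u ∈ S) ×
    (∀ u v → u ∈ S → v ∈ S → ∃ λ p → IsPath S u v p)

  Geodetic : Subset n → Set
  Geodetic S = ∀ u v → u ∈ S → v ∈ S →
    (∃ λ p → IsGeodesic S u v p) ×
    (∀ p q → IsGeodesic S u v p → IsGeodesic S u v q → p ≡ q)

  HereditarilyGeodetic : Set
  HereditarilyGeodetic = ∀ S → Connected S → Geodetic S

  IsCutVertex : Subset n → Fin n → Set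
  IsCutVertex S c = c ∈ S × (Σ (Fin n) λ x → Σ (Fin n) λ y →
    x ∈ S × y ∈ S × x ≢ c × y ≢ c ×
    (∃ λ p → IsPath S x y p) × ¬ (∃ λ p → IsPath (S - c) x y p))

  Biconnected : Subset n → Set
  Biconnected S = Connected S × (∀ c → ¬ IsCutVertex S c)

  -- a block: a maximal connected subgraph without a cut vertex
  -- (maximal such subgraphs are induced, so blocks are given by vertex sets)
  IsBlock : Subset n → Set
  IsBlock B = Biconnected B × (∀ B′ → B ⊆ B′ → Biconnected B′ → B′ ⊆ B)

  IsComplete : Subset n → Set
  IsComplete B = ∀ u v → u ∈ B → v ∈ B → u ≢ v → Adj u v

  IsOddCycle : Subset n → Set
  IsOddCycle B = Σ ℕ λ k → Σ (Fin (3 + 2 * k) → Fin n) λ f →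
    (∀ i j → f i ≡ f j → i ≡ j) ×
    (∀ i → f i ∈ B) ×
    (∀ v → v ∈ B → ∃ λ i → f i ≡ v) ×
    (∀ i j → Adj (f i) (f j) ⇔
      (toℕ j ≡ suc (toℕ i) % (3 + 2 * k) ⊎ toℕ i ≡ suc (toℕ j) % (3 + 2 * k)))

{-# OPTIONS --safe #-}
-- In a hereditarily geodetic graph there is no even cycle of length at least 4 whose chords all join vertices at
-- equal distance from a base vertex: its two halves between the base vertex and the antipodal one would both be
-- geodesics of the subgraph it induces, since the distance along the cycle is 1-Lipschitz there. Closing segments of
-- an induced path q through an outside vertex w produces such cycles, so w has at most two neighbours on q, and they
-- are at odd distance.
-- Let B be biconnected and not complete. A geodesic of B between non-adjacent vertices starts with an induced path
-- x w y, and w closes a geodesic from x to y in B - w to an induced odd cycle C of length at least 5. If a vertex of B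
-- outside C were adjacent to C, a geodesic avoiding one cycle vertex c₀ would contain an induced path e whose edges
-- to C go to c₀ and, from its last vertex only, to one other cycle vertex. Glued to either arc of C between these two
-- vertices, e gives an induced path avoiding c₀ with both ends adjacent to c₀, hence of odd length; but the two odd
-- lengths add up to twice the length of e plus the odd length of C. So C spans B.

module Submission where

open import Defs
open import Data.Bool using (true)
open import Data.Empty using (⊥; ⊥-elim)
import Data.Fin as Fin
open import Data.Fin using (Fin; toℕ; fromℕ<) renaming (_≟_ to _≟ᶠ_)
open import Data.Fin.Properties using (toℕ-injective; toℕ-fromℕ<; toℕ<n; injective⇒≤; any?)
open import Data.Fin.Subset using (Subset; _∈_; _∉_; _─_; _-_; ⁅_⁆; outside; inside)
open import Data.Fin.Subset.Properties using (_∈?_; p─q⊆p; x∈p∧x≢y⇒x∈p-y; x∈⁅x⁆)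
open import Data.List using (List; []; _∷_; length; head; last; applyUpTo)
open import Data.List.Properties using (length-applyUpTo)
open import Data.List.Relation.Unary.All as All using (All; _∷_)
import Data.List.Relation.Unary.All.Properties as All
open import Data.List.Relation.Unary.Linked using (Linked; _∷_; linked?)
import Data.List.Relation.Unary.Linked.Properties as Linked
open import Data.List.Relation.Unary.Unique.Propositional using (Unique)
import Data.List.Relation.Unary.Unique.Propositional.Properties as Unique
import Data.List.Relation.Unary.Unique.DecPropositional as Unique
open import Data.List.Relation.Unary.AllPairs using ([]; _∷_)
open import Data.Maybe using (just)
open import Data.Maybe.Properties using (just-injective; ≡-dec)
open import Data.Nat using (ℕ; zero; suc; _+_; _*_; _∸_; _≤_; _<_; z≤n; s≤s; _≟_; _<?_; _%_; NonZero)
open import Data.Nat.DivMod using (m≤n⇒m%n≡m; n%n≡0; m%n<n; m%n%n≡m%n; %-distribˡ-+; [m+n]%n≡m%n)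
open import Data.Nat.Properties
open import Data.Nat.Tactic.RingSolver using (solve-∀)
open import Data.Product using (∃; _×_; _,_; proj₁; proj₂)
open import Data.Sum using (_⊎_; inj₁; inj₂)
open import Data.Vec using (tabulate; _∷_; here; there)
open import Data.Vec.Properties using ([]=⇒lookup; lookup⇒[]=; lookup∘tabulate)
open import Function using (_∘_)
open import Function.Bundles using (mk⇔)
open import Relation.Binary.PropositionalEquality
open import Relation.Nullary using (¬_; Dec; yes; no; does)
open import Relation.Binary using (tri<; tri≈; tri>)
open import Relation.Nullary.Decidable using (_×-dec_; ¬?; map′; decidable-stable)

≢0∧≢1⇒≥2 : ∀ {m} → m ≢ 0 → m ≢ 1 → 2 ≤ m
≢0∧≢1⇒≥2 {zero}        m≢0 _   = ⊥-elim (m≢0 refl)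
≢0∧≢1⇒≥2 {suc zero}    _   m≢1 = ⊥-elim (m≢1 refl)
≢0∧≢1⇒≥2 {suc (suc m)} _   _   = s≤s (s≤s z≤n)

endpoint-or-interior : ∀ {l D} → l ≤ D → l ≡ 0 ⊎ l ≡ D ⊎ (0 < l × l < D)
endpoint-or-interior {zero}  _   = inj₁ refl
endpoint-or-interior {suc l} l≤D with m≤n⇒m<n∨m≡n l≤D
... | inj₁ l<D  = inj₂ (inj₂ (s≤s z≤n , l<D))
... | inj₂ refl = inj₂ (inj₁ refl)

even-or-odd : ∀ m → ∃ λ s → m ≡ s + s ⊎ m ≡ suc (s + s)
even-or-odd zero = 0 , inj₁ refl
even-or-odd (suc m) with even-or-odd m
... | s , inj₁ refl = s , inj₂ refl
... | s , inj₂ refl = suc s , inj₁ (cong suc (sym (+-suc s s)))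

double≢odd : ∀ a b → a + a ≢ suc (b + b)
double≢odd a b e = even≢odd a b (trans (cong (a +_) (+-identityʳ a)) (trans e (cong (λ x → suc (b + x)) (sym (+-identityʳ b)))))

2+odd+odd≡double : ∀ a b → suc (suc (suc (a + a) + suc (b + b))) ≡ suc (suc (a + b)) + suc (suc (a + b))
2+odd+odd≡double = solve-∀

-- Two paths of odd lengths j + 1 + x and j + 1 + δ sharing j edges cannot close a cycle of odd length x + δ + 2.
odd-ear-parity : ∀ {j x δ s a b} → suc (x + δ) ≡ s + s → j + suc x ≡ suc (a + a) → j + suc δ ≡ suc (b + b) → ⊥
odd-ear-parity {j} {x} {δ} {s} {a} {b} cycle≡ e₁ e₂ = double≢odd (suc (a + b)) (j + s) (begin
  suc (a + b) + suc (a + b)      ≡⟨ rearrange₁ a b ⟩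
  suc (a + a) + suc (b + b)      ≡⟨ cong₂ _+_ e₁ e₂ ⟨
  (j + suc x) + (j + suc δ)      ≡⟨ rearrange₂ j x δ ⟩
  suc ((j + j) + suc (x + δ))    ≡⟨ cong (λ y → suc ((j + j) + y)) cycle≡ ⟩
  suc ((j + j) + (s + s))        ≡⟨ rearrange₃ j s ⟩
  suc ((j + s) + (j + s))        ∎)
  where
  open ≡-Reasoning
  rearrange₁ : ∀ a b → suc (a + b) + suc (a + b) ≡ suc (a + a) + suc (b + b)
  rearrange₁ = solve-∀
  rearrange₂ : ∀ j x δ → (j + suc x) + (j + suc δ) ≡ suc ((j + j) + suc (x + δ))
  rearrange₂ = solve-∀
  rearrange₃ : ∀ j s → suc ((j + j) + (s + s)) ≡ suc ((j + s) + (j + s))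
  rearrange₃ = solve-∀

positive-double : ∀ {m s} → suc m ≡ s + s → ∃ λ k → suc m ≡ suc k + suc k
positive-double {s = suc k} e = k , e

3+2k≡ : ∀ k → 3 + 2 * k ≡ suc (suc k + suc k)
3+2k≡ = solve-∀

sort3 : {Q : ℕ → Set} → ∀ {a b c} → a ≢ b → b ≢ c → a ≢ c → Q a → Q b → Q c →
        ∃ λ i → ∃ λ j → ∃ λ k → i < j × j < k × Q i × Q j × Q k
sort3 {a = a} {b} {c} a≢b b≢c a≢c qa qb qc with <-cmp a b | <-cmp b c | <-cmp a c
... | tri≈ _ e _ | _          | _          = ⊥-elim (a≢b e)
... | _          | tri≈ _ e _ | _          = ⊥-elim (b≢c e)
... | _          | _          | tri≈ _ e _ = ⊥-elim (a≢c e)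
... | tri< x _ _ | tri< y _ _ | _          = a , b , c , x , y , qa , qb , qc
... | tri< x _ _ | tri> _ _ y | tri< z _ _ = a , c , b , z , y , qa , qc , qb
... | tri< x _ _ | tri> _ _ y | tri> _ _ z = c , a , b , z , x , qc , qa , qb
... | tri> _ _ x | tri< y _ _ | tri< z _ _ = b , a , c , x , z , qb , qa , qc
... | tri> _ _ x | tri< y _ _ | tri> _ _ z = b , c , a , y , z , qb , qc , qa
... | tri> _ _ x | tri> _ _ y | _          = c , b , a , y , x , qc , qb , qa

avoid-three : ∀ {i j k} → i < j → j < k → ∃ λ f → f ≤ 3 × f ≢ i × f ≢ j × f ≢ k
avoid-three {suc i} i<j j<k = 0 , z≤n , (λ ()) , <⇒≢ 0<j , <⇒≢ (<-trans 0<j j<k)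
  where 0<j = ≤-trans (s≤s z≤n) i<j
avoid-three {zero} {suc (suc j)} _ j<k = 1 , s≤s z≤n , (λ ()) , (λ ()) , <⇒≢ (≤-trans (s≤s (s≤s z≤n)) j<k)
avoid-three {zero} {1} {suc (suc (suc k))} _ _ = 2 , s≤s (s≤s z≤n) , (λ ()) , (λ ()) , (λ ())
avoid-three {zero} {1} {2} _ _ = 3 , ≤-refl , (λ ()) , (λ ()) , (λ ())
avoid-three {zero} {1} {1} _ (s≤s ())

anyUpTo≤? : {P : ℕ → Set} → (∀ l → Dec (P l)) → ∀ T → Dec (∃ λ l → l ≤ T × P l)
anyUpTo≤? P? T = map′ (λ { (l , s≤s l≤T , p) → l , l≤T , p }) (λ { (l , l≤T , p) → l , s≤s l≤T , p })
                      (anyUpTo? P? (suc T))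

least-witness : {P : ℕ → Set} → (∀ l → Dec (P l)) → ∀ {T} → (∃ λ l → l ≤ T × P l) →
                ∃ λ l → l ≤ T × P l × (∀ l' → l' < l → ¬ P l')
least-witness P? {zero} (zero , _ , p) = 0 , z≤n , p , λ _ ()
least-witness P? {suc T} (l , l≤ , p) with anyUpTo≤? P? T
... | yes earlier = let (l₀ , l₀≤ , p₀ , least) = least-witness P? earlier in l₀ , m≤n⇒m≤1+n l₀≤ , p₀ , least
... | no none with m≤n⇒m<n∨m≡n l≤
...   | inj₁ l<  = ⊥-elim (none (l , ≤-pred l< , p))
...   | inj₂ refl = suc T , ≤-refl , p , λ l' l'< p' → none (l' , ≤-pred l'< , p')

nearest-below : {P : ℕ → Set} → (∀ l → Dec (P l)) → ∀ {i j} → i < j → P i →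
                ∃ λ i' → i ≤ i' × i' < j × P i' × (∀ l → i' < l → l < j → ¬ P l)
nearest-below {P} P? {i} {suc j} (s≤s i≤j) p with P? j
... | yes pj = j , i≤j , ≤-refl , pj , λ l j<l l<sj → ⊥-elim (<⇒≱ j<l (≤-pred l<sj))
... | no ¬pj with m≤n⇒m<n∨m≡n i≤j
...   | inj₂ refl = ⊥-elim (¬pj p)
...   | inj₁ i<j with nearest-below P? i<j p
...     | i' , i≤i' , i'<j , pi' , between = i' , i≤i' , m≤n⇒m≤1+n i'<j , pi' , between'
  where
  between' : ∀ l → i' < l → l < suc j → ¬ P l
  between' l i'<l l<sj with m≤n⇒m<n∨m≡n (≤-pred l<sj)
  ... | inj₁ l<j  = between l i'<l l<j
  ... | inj₂ refl = ¬pj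

nearest-above : {P : ℕ → Set} → (∀ l → Dec (P l)) → ∀ {j k} → j < k → P k →
                ∃ λ k' → j < k' × k' ≤ k × P k' × (∀ l → j < l → l < k' → ¬ P l)
nearest-above P? {j} j<k p with least-witness (λ l → j <? l ×-dec P? l) (_ , ≤-refl , j<k , p)
... | k' , k'≤k , (j<k' , pk') , least = k' , j<k' , k'≤k , pk' , λ l j<l l<k' pl → least l l<k' (j<l , pl)

InjectiveUpTo : {A : Set} → (ℕ → A) → ℕ → Set
InjectiveUpTo h T = ∀ l l' → l ≤ T → l' ≤ T → h l ≡ h l' → l ≡ l'

injectiveUpTo-≤ : ∀ {A : Set} {h : ℕ → A} {T T'} → InjectiveUpTo h T → T' ≤ T → InjectiveUpTo h T'
injectiveUpTo-≤ inj T'≤T l l' l≤ l'≤ = inj l l' (≤-trans l≤ T'≤T) (≤-trans l'≤ T'≤T)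

injectiveUpTo-shift : ∀ {A : Set} {h : ℕ → A} {T} → InjectiveUpTo h T →
                      ∀ a {T'} → a + T' ≤ T → InjectiveUpTo (λ l → h (a + l)) T'
injectiveUpTo-shift inj a le l l' l≤ l'≤ eq = +-cancelˡ-≡ a l l'
  (inj (a + l) (a + l') (≤-trans (+-monoʳ-≤ a l≤) le) (≤-trans (+-monoʳ-≤ a l'≤) le) eq)

injectiveUpTo-reverse : ∀ {A : Set} {h : ℕ → A} {T} → InjectiveUpTo h T → InjectiveUpTo (λ l → h (T ∸ l)) T
injectiveUpTo-reverse {T = T} inj l l' l≤ l'≤ eq =
  ∸-cancelˡ-≡ l≤ l'≤ (inj (T ∸ l) (T ∸ l') (m∸n≤m T l) (m∸n≤m T l') eq)

glue : {A : Set} → (ℕ → A) → ℕ → (ℕ → A) → ℕ → A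
glue f a g l with ≤-<-connex l a
... | inj₁ _ = f l
... | inj₂ _ = g (l ∸ suc a)

module _ {A : Set} (f : ℕ → A) (a : ℕ) (g : ℕ → A) where

  glue-≤ : ∀ {l} → l ≤ a → glue f a g l ≡ f l
  glue-≤ {l} l≤a with ≤-<-connex l a
  ... | inj₁ _ = refl
  ... | inj₂ a<l = ⊥-elim (<⇒≱ a<l l≤a)

  glue-> : ∀ {l} → a < l → glue f a g l ≡ g (l ∸ suc a)
  glue-> {l} a<l with ≤-<-connex l a
  ... | inj₁ l≤a = ⊥-elim (<⇒≱ a<l l≤a)
  ... | inj₂ _ = refl

  glue-end : ∀ b → glue f a g (a + suc b) ≡ g b
  glue-end b = trans (glue-> (≤-trans (s≤s (m≤m+n a b)) (≤-reflexive (sym (+-suc a b)))))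
                     (cong g (trans (cong (_∸ suc a) (+-suc a b)) (m+n∸m≡n a b)))

glue-index : ∀ a b {l} → a < l → l ≤ a + suc b → l ∸ suc a ≤ b
glue-index a b a<l l≤ = ≤-trans (∸-monoˡ-≤ (suc a) l≤) (≤-reflexive (trans (cong (_∸ suc a) (+-suc a b)) (m+n∸m≡n a b)))

injectiveUpTo-glue : ∀ {A : Set} {f g : ℕ → A} {a b} → InjectiveUpTo f a → InjectiveUpTo g b →
                     (∀ l l' → l ≤ a → l' ≤ b → f l ≢ g l') → InjectiveUpTo (glue f a g) (a + suc b)
injectiveUpTo-glue {f = f} {g} {a} {b} inj-f inj-g disjoint l l' l≤ l'≤ eq
  with ≤-<-connex l a | ≤-<-connex l' a
... | inj₁ p | inj₁ q = inj-f l l' p q eq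
... | inj₂ p | inj₂ q = ∸-cancelʳ-≡ p q (inj-g _ _ (glue-index a b p l≤) (glue-index a b q l'≤) eq)
... | inj₁ p | inj₂ q = ⊥-elim (disjoint l _ p (glue-index a b q l'≤) eq)
... | inj₂ p | inj₁ q = ⊥-elim (disjoint l' _ q (glue-index a b p l≤) (sym eq))

cons : {A : Set} → A → (ℕ → A) → ℕ → A
cons a f zero    = a
cons a f (suc l) = f l

next : ℕ → ℕ → ℕ
next M l = suc l % suc M

next-< : ∀ {M l} → l < M → next M l ≡ suc l
next-< l<M = m≤n⇒m%n≡m l<M

next-last : ∀ M → next M M ≡ 0
next-last M = n%n≡0 (suc M)

next-≤ : ∀ M l → next M l ≤ M
next-≤ M l = ≤-pred (m%n<n (suc l) (suc M))

next-% : ∀ {M m} l .{{_ : NonZero m}} → suc M ≡ m → next M l ≡ suc l % m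
next-% l refl = refl

%-absorbˡ : ∀ m n d .{{_ : NonZero d}} → (m % d + n) % d ≡ (m + n) % d
%-absorbˡ m n d = begin
  (m % d + n) % d         ≡⟨ %-distribˡ-+ (m % d) n d ⟩
  (m % d % d + n % d) % d ≡⟨ cong (λ x → (x + n % d) % d) (m%n%n≡m%n m d) ⟩
  (m % d + n % d) % d     ≡⟨ %-distribˡ-+ m n d ⟨
  (m + n) % d             ∎
  where open ≡-Reasoning

suc-%-absorb : ∀ m d .{{_ : NonZero d}} → suc (m % d) % d ≡ suc m % d
suc-%-absorb m d = begin
  suc (m % d) % d ≡⟨ cong (_% d) (+-comm 1 (m % d)) ⟩
  (m % d + 1) % d ≡⟨ %-absorbˡ m 1 d ⟩
  (m + 1) % d     ≡⟨ cong (_% d) (+-comm m 1) ⟩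
  suc m % d       ∎
  where open ≡-Reasoning

module Rotation (M p : ℕ) (p≤M : p ≤ M) where

  rotate : ℕ → ℕ
  rotate l = (l + p) % suc M

  unrotate : ℕ → ℕ
  unrotate a = (a + (suc M ∸ p)) % suc M

  rotate-≤ : ∀ l → rotate l ≤ M
  rotate-≤ l = ≤-pred (m%n<n (l + p) (suc M))

  unrotate-≤ : ∀ a → unrotate a ≤ M
  unrotate-≤ a = ≤-pred (m%n<n (a + (suc M ∸ p)) (suc M))

  rotate-zero : rotate 0 ≡ p
  rotate-zero = m≤n⇒m%n≡m p≤M

  rotate-next : ∀ l → rotate (next M l) ≡ next M (rotate l)
  rotate-next l = trans (%-absorbˡ (suc l) p (suc M)) (sym (suc-%-absorb (l + p) (suc M)))

  unrotate-rotate : ∀ {l} → l ≤ M → unrotate (rotate l) ≡ l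
  unrotate-rotate {l} l≤M = begin
    ((l + p) % suc M + (suc M ∸ p)) % suc M ≡⟨ %-absorbˡ (l + p) (suc M ∸ p) (suc M) ⟩
    (l + p + (suc M ∸ p)) % suc M           ≡⟨ cong (_% suc M) (+-assoc l p (suc M ∸ p)) ⟩
    (l + (p + (suc M ∸ p))) % suc M         ≡⟨ cong (λ x → (l + x) % suc M) (m+[n∸m]≡n (m≤n⇒m≤1+n p≤M)) ⟩
    (l + suc M) % suc M                     ≡⟨ [m+n]%n≡m%n l (suc M) ⟩
    l % suc M                               ≡⟨ m≤n⇒m%n≡m l≤M ⟩
    l                                       ∎
    where open ≡-Reasoning

  rotate-unrotate : ∀ {a} → a ≤ M → rotate (unrotate a) ≡ a
  rotate-unrotate {a} a≤M = begin
    ((a + (suc M ∸ p)) % suc M + p) % suc M ≡⟨ %-absorbˡ (a + (suc M ∸ p)) p (suc M) ⟩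
    (a + (suc M ∸ p) + p) % suc M           ≡⟨ cong (_% suc M) (+-assoc a (suc M ∸ p) p) ⟩
    (a + (suc M ∸ p + p)) % suc M           ≡⟨ cong (λ x → (a + x) % suc M) (m∸n+n≡m (m≤n⇒m≤1+n p≤M)) ⟩
    (a + suc M) % suc M                     ≡⟨ [m+n]%n≡m%n a (suc M) ⟩
    a % suc M                               ≡⟨ m≤n⇒m%n≡m a≤M ⟩
    a                                       ∎
    where open ≡-Reasoning

  rotate-injective : ∀ {l l'} → l ≤ M → l' ≤ M → rotate l ≡ rotate l' → l ≡ l'
  rotate-injective {l} {l'} l≤M l'≤M eq =
    trans (sym (unrotate-rotate l≤M)) (trans (cong unrotate eq) (unrotate-rotate l'≤M))

  rotate-preimage : ∀ {a} → a ≤ M → a ≢ p → ∃ λ m → m < M × rotate (suc m) ≡ a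
  rotate-preimage {a} a≤M a≢p with unrotate a in eq
  ... | zero  = ⊥-elim (a≢p (trans (sym (rotate-unrotate a≤M)) (trans (cong rotate eq) rotate-zero)))
  ... | suc m = m , subst (_≤ M) eq (unrotate-≤ a) , trans (cong rotate (sym eq)) (rotate-unrotate a≤M)

CyclicallyAdjacent : ℕ → ℕ → ℕ → Set
CyclicallyAdjacent M l l' = l' ≡ next M l ⊎ l ≡ next M l'

cyclicallyAdjacent-unrotate : ∀ M {p} (p≤M : p ≤ M) → let open Rotation M p p≤M in
  ∀ {l l'} → l ≤ M → l' ≤ M → CyclicallyAdjacent M (rotate l) (rotate l') → CyclicallyAdjacent M l l'
cyclicallyAdjacent-unrotate M p≤M {l} {l'} l≤ l'≤ (inj₁ e) =
  inj₁ (Rotation.rotate-injective M _ p≤M l'≤ (next-≤ M l) (trans e (sym (Rotation.rotate-next M _ p≤M l))))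
cyclicallyAdjacent-unrotate M p≤M {l} {l'} l≤ l'≤ (inj₂ e) =
  inj₂ (Rotation.rotate-injective M _ p≤M l≤ (next-≤ M l') (trans e (sym (Rotation.rotate-next M _ p≤M l'))))

-- The distance of vertex l from vertex 0 on a cycle of length K + K.
cycleDistance : ℕ → ℕ → ℕ
cycleDistance K l with ≤-<-connex l K
... | inj₁ _ = l
... | inj₂ _ = K + K ∸ l

cycleDistance-≤ : ∀ {K l} → l ≤ K → cycleDistance K l ≡ l
cycleDistance-≤ {K} {l} l≤K with ≤-<-connex l K
... | inj₁ _ = refl
... | inj₂ K<l = ⊥-elim (<⇒≱ K<l l≤K)

cycleDistance-≥ : ∀ {K l} → K ≤ l → cycleDistance K l ≡ K + K ∸ l
cycleDistance-≥ {K} {l} K≤l with ≤-<-connex l K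
... | inj₁ l≤K rewrite ≤-antisym l≤K K≤l = sym (m+n∸n≡m K K)
... | inj₂ _ = refl

cycleDistance-next : ∀ {K M} → suc M ≡ K + K → K < M → ∀ {l} → l ≤ M →
                     cycleDistance K (next M l) ≤ suc (cycleDistance K l) ×
                     cycleDistance K l ≤ suc (cycleDistance K (next M l))
cycleDistance-next {K} {M} M≡ K<M {l} l≤M with m≤n⇒m<n∨m≡n l≤M
... | inj₂ refl rewrite next-last M =
  subst (_≤ suc (cycleDistance K M)) (sym distance-first) z≤n , ≤-reflexive (trans distance-last (cong suc (sym distance-first)))
  where
  distance-first : cycleDistance K 0 ≡ 0
  distance-first = cycleDistance-≤ {K} z≤n
  distance-last : cycleDistance K M ≡ 1
  distance-last = trans (cycleDistance-≥ (<⇒≤ K<M)) (trans (cong (_∸ M) (sym M≡)) (m+n∸n≡m 1 M))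
... | inj₁ l<M rewrite next-< l<M = step (≤-<-connex (suc l) K)
  where
  step : suc l ≤ K ⊎ K < suc l →
         cycleDistance K (suc l) ≤ suc (cycleDistance K l) × cycleDistance K l ≤ suc (cycleDistance K (suc l))
  step (inj₁ sl≤K) rewrite cycleDistance-≤ sl≤K | cycleDistance-≤ (≤-trans (n≤1+n l) sl≤K) =
    ≤-refl , ≤-trans (n≤1+n l) (n≤1+n (suc l))
  step (inj₂ K<sl) = subst (λ x → cycleDistance K (suc l) ≤ suc x) (sym descending) (≤-trans (n≤1+n _) (n≤1+n _)) , ≤-reflexive descending
    where
    descending : cycleDistance K l ≡ suc (cycleDistance K (suc l))
    descending = begin
      cycleDistance K l             ≡⟨ cycleDistance-≥ (≤-pred K<sl) ⟩
      K + K ∸ l                     ≡⟨ +-∸-assoc 1 (≤-trans l<M (≤-trans (n≤1+n M) (≤-reflexive M≡))) ⟩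
      suc (K + K ∸ suc l)           ≡⟨ cong suc (cycleDistance-≥ (<⇒≤ K<sl)) ⟨
      suc (cycleDistance K (suc l)) ∎
      where open ≡-Reasoning

module FanChord {K M c} (M≡ : suc M ≡ K + K) (c<K : c < K) where

  c+c≤M : c + c ≤ M
  c+c≤M = ≤-pred (subst (suc (c + c) ≤_) (sym M≡) (+-mono-< c<K c<K))

  c≤M : c ≤ M
  c≤M = ≤-trans (m≤m+n c c) c+c≤M

  open Rotation M c c≤M

  rotate≡0⇒distance≡ : 0 < c → ∀ {l} → l ≤ M → rotate l ≡ 0 → cycleDistance K l ≡ c
  rotate≡0⇒distance≡ 0<c {l} l≤M e = begin
    cycleDistance K l            ≡⟨ cong (cycleDistance K) (rotate-injective l≤M (∸-monoʳ-≤ (suc M) 0<c) (trans e (sym rotate-antipode))) ⟩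
    cycleDistance K (suc M ∸ c)  ≡⟨ cong (λ x → cycleDistance K (x ∸ c)) M≡ ⟩
    cycleDistance K (K + K ∸ c)  ≡⟨ cycleDistance-≥ (subst (K ≤_) (sym (+-∸-assoc K (<⇒≤ c<K))) (m≤m+n K (K ∸ c))) ⟩
    K + K ∸ (K + K ∸ c)          ≡⟨ m∸[m∸n]≡n (≤-trans (<⇒≤ c<K) (m≤m+n K K)) ⟩
    c                            ∎
    where
    open ≡-Reasoning
    rotate-antipode : rotate (suc M ∸ c) ≡ 0
    rotate-antipode = trans (cong (_% suc M) (m∸n+n≡m (m≤n⇒m≤1+n c≤M))) (n%n≡0 (suc M))

  rotate≡c+c⇒distance≡ : ∀ {l} → l ≤ M → rotate l ≡ c + c → cycleDistance K l ≡ c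
  rotate≡c+c⇒distance≡ l≤M e =
    trans (cong (cycleDistance K) (rotate-injective l≤M c≤M (trans e (sym (m≤n⇒m%n≡m c+c≤M))))) (cycleDistance-≤ (<⇒≤ c<K))

-- The list x ∷ xs as a function; indices beyond its end give junk values.
at : {A : Set} → A → List A → ℕ → A
at x []       _       = x
at x (y ∷ ys) zero    = x
at x (y ∷ ys) (suc l) = at y ys l

module _ {A : Set} where

  at-zero : (x : A) (xs : List A) → at x xs 0 ≡ x
  at-zero x []      = refl
  at-zero x (_ ∷ _) = refl

  at-last : (x : A) (xs : List A) → last (x ∷ xs) ≡ just (at x xs (length xs))
  at-last x []       = refl
  at-last x (y ∷ ys) = at-last y ys

  at-all : ∀ {P : A → Set} {x xs} → All P (x ∷ xs) → ∀ l → P (at x xs l)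
  at-all {xs = []}    (p ∷ _)  _       = p
  at-all {xs = _ ∷ _} (p ∷ _)  zero    = p
  at-all {xs = _ ∷ _} (_ ∷ ps) (suc l) = at-all ps l

  at-linked : ∀ {R : A → A → Set} {x xs} → Linked R (x ∷ xs) →
              ∀ l → l < length xs → R (at x xs l) (at x xs (suc l))
  at-linked {R = R} {x} {y ∷ ys} (r ∷ _) zero _ = subst (R x) (sym (at-zero y ys)) r
  at-linked {xs = _ ∷ _} (_ ∷ rs) (suc l) (s≤s l<) = at-linked rs l l<

  at-injective : ∀ {x : A} {xs} → Unique (x ∷ xs) → InjectiveUpTo (at x xs) (length xs)
  at-injective {xs = []}    _        zero    zero    _       _       _  = refl
  at-injective {xs = _ ∷ _} _        zero    zero    _       _       _  = refl
  at-injective {xs = _ ∷ _} (x∉ ∷ _) zero    (suc l') _      _       eq = ⊥-elim (at-all x∉ l' eq)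
  at-injective {xs = _ ∷ _} (x∉ ∷ _) (suc l) zero    _       _       eq = ⊥-elim (at-all x∉ l (sym eq))
  at-injective {xs = _ ∷ _} (_ ∷ u)  (suc l) (suc l') (s≤s p) (s≤s q) eq = cong suc (at-injective u l l' p q eq)

last-applyUpTo : {A : Set} (h : ℕ → A) (T : ℕ) → last (applyUpTo h (suc T)) ≡ just (h T)
last-applyUpTo h zero    = refl
last-applyUpTo h (suc T) = last-applyUpTo (h ∘ suc) T

unique-length≤ : ∀ {n} (xs : List (Fin n)) → Unique xs → length xs ≤ n
unique-length≤ []       _ = z≤n
unique-length≤ (x ∷ xs) u = injective⇒≤ {f = λ i → at x xs (toℕ i)}
  (λ {i} {j} e → toℕ-injective (at-injective u (toℕ i) (toℕ j) (≤-pred (toℕ<n i)) (≤-pred (toℕ<n j)) e))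

shortList? : ∀ {n} k {P : List (Fin n) → Set} → (∀ xs → Dec (P xs)) → Dec (∃ λ xs → length xs ≤ k × P xs)
shortList? zero P? with P? []
... | yes p = yes ([] , z≤n , p)
... | no ¬p = no λ { ([] , _ , p) → ¬p p ; (_ ∷ _ , () , _) }
shortList? (suc k) P? with P? []
... | yes p = yes ([] , z≤n , p)
... | no ¬p with any? (λ x → shortList? k (λ ys → P? (x ∷ ys)))
...   | yes (x , ys , ys≤ , p) = yes (x ∷ ys , s≤s ys≤ , p)
...   | no ¬q = no λ { ([] , _ , p) → ¬p p ; (x ∷ ys , s≤s ys≤ , p) → ¬q (x , ys , ys≤ , p) }

x∈p─q⇒x∉q : ∀ {n} (p q : Subset n) {x} → x ∈ p ─ q → x ∉ q
x∈p─q⇒x∉q (_ ∷ p) (outside ∷ q) {Fin.zero}  here      ()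
x∈p─q⇒x∉q (_ ∷ p) (inside ∷ q)  {Fin.zero}  ()        _
x∈p─q⇒x∉q (_ ∷ p) (_ ∷ q)       {Fin.suc x} (there m) (there m') = x∈p─q⇒x∉q p q m m'

∈-minus : ∀ {n} {B : Subset n} {w x} → x ∈ B - w → x ∈ B × x ≢ w
∈-minus {B = B} {w} x∈ = p─q⊆p B ⁅ w ⁆ x∈ , λ { refl → x∈p─q⇒x∉q B ⁅ w ⁆ x∈ (x∈⁅x⁆ w) }

module _ {n : ℕ} (h : ℕ → Fin n) (T : ℕ) where

  Occurs : Fin n → Set
  Occurs x = ∃ λ l → l ≤ T × h l ≡ x

  occurs? : ∀ x → Dec (Occurs x)
  occurs? x = anyUpTo≤? (λ l → h l ≟ᶠ x) T

  image : Subset n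
  image = tabulate (does ∘ occurs?)

  ∈-image : ∀ {l} → l ≤ T → h l ∈ image
  ∈-image {l} l≤ = lookup⇒[]= (h l) image (trans (lookup∘tabulate (does ∘ occurs?) (h l)) (yes-does (occurs? (h l))))
    where
    yes-does : (d : Dec (Occurs (h l))) → does d ≡ true
    yes-does (yes _) = refl
    yes-does (no ¬o) = ⊥-elim (¬o (l , l≤ , refl))

  image-occurs : ∀ {x} → x ∈ image → Occurs x
  image-occurs {x} x∈ = true-does (occurs? x) (trans (sym (lookup∘tabulate (does ∘ occurs?) x)) ([]=⇒lookup x∈))
    where
    true-does : (d : Dec (Occurs x)) → does d ≡ true → Occurs x
    true-does (yes o) _ = o

  index : Fin n → ℕ
  index x with occurs? x
  ... | yes (l , _) = l
  ... | no _ = 0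

  index-correct : InjectiveUpTo h T → ∀ {l} → l ≤ T → index (h l) ≡ l
  index-correct inj {l} l≤ with occurs? (h l)
  ... | yes (l' , l'≤ , eq) = inj l' l l'≤ l≤ eq
  ... | no ¬o = ⊥-elim (¬o (l , l≤ , refl))

-- Walks, paths and cycles as index functions

module _ {n : ℕ} (G : Graph n) where
  open Graph G renaming (sym to Adj-sym)

  IsWalk : (ℕ → Fin n) → ℕ → Set
  IsWalk h T = ∀ l → l < T → Adj (h l) (h (suc l))

  isWalk-shift : ∀ {h T} → IsWalk h T → ∀ a {T'} → a + T' ≤ T → IsWalk (λ l → h (a + l)) T'
  isWalk-shift {h} walk a {T'} le l l< = subst (λ z → Adj (h (a + l)) (h z)) (sym (+-suc a l))
    (walk (a + l) (≤-trans (subst (_≤ a + T') (+-suc a l) (+-monoʳ-≤ a l<)) le))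

  isWalk-reverse : ∀ {h T} → IsWalk h T → IsWalk (λ l → h (T ∸ l)) T
  isWalk-reverse {h} {T} walk l l< = subst (λ z → Adj (h z) (h (T ∸ suc l))) (sym T∸l≡)
    (Adj-sym (walk (T ∸ suc l) (≤-trans (≤-reflexive (sym T∸l≡)) (m∸n≤m T l))))
    where
    T∸l≡ : T ∸ l ≡ suc (T ∸ suc l)
    T∸l≡ = +-∸-assoc 1 l<

  isWalk-glue : ∀ {f g a b} → IsWalk f a → IsWalk g b → Adj (f a) (g 0) → IsWalk (glue f a g) (a + suc b)
  isWalk-glue {f} {g} {a} {b} walk-f walk-g bridge l l< with ≤-<-connex (suc l) a | ≤-<-connex l a
  ... | inj₁ sl≤a | inj₁ _   = walk-f l sl≤a
  ... | inj₁ sl≤a | inj₂ a<l = ⊥-elim (<⇒≱ a<l (≤-trans (n≤1+n l) sl≤a))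
  ... | inj₂ a<sl | inj₁ l≤a rewrite ≤-antisym l≤a (≤-pred a<sl) | n∸n≡0 a = bridge
  ... | inj₂ a<sl | inj₂ a<l = subst (λ z → Adj (g (l ∸ suc a)) (g z)) (sym (+-∸-assoc 1 a<l))
                                 (walk-g (l ∸ suc a) (≤-trans (≤-reflexive (sym (+-∸-assoc 1 a<l))) (glue-index a b a<sl l<)))

  isWalk-≤ : ∀ {h T T'} → IsWalk h T → T' ≤ T → IsWalk h T'
  isWalk-≤ walk T'≤T l l< = walk l (≤-trans l< T'≤T)

  pathList : (ℕ → Fin n) → ℕ → List (Fin n)
  pathList h T = applyUpTo h (suc T)

  isPath-pathList : ∀ {S h T} → IsWalk h T → InjectiveUpTo h T → (∀ l → l ≤ T → h l ∈ S) →
                    IsPath G S (h 0) (h T) (pathList h T)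
  isPath-pathList {S} {h} {T} walk inj within = record
    { start  = refl
    ; end    = last-applyUpTo h T
    ; inS    = All.applyUpTo⁺₁ h (suc T) (λ l< → within _ (≤-pred l<))
    ; linked = Linked.applyUpTo⁺₁ h (suc T) (λ sl< → walk _ (≤-pred sl<))
    ; unique = Unique.applyUpTo⁺₁ h (suc T)
                 (λ {i} {j} i<j j< eq → <⇒≢ i<j (inj i j (≤-trans (<⇒≤ i<j) (≤-pred j<)) (≤-pred j<) eq))
    }

  record Indexing (S : Subset n) (u v : Fin n) (p : List (Fin n)) : Set where
    field
      vertex    : ℕ → Fin n
      len       : ℕ
      length≡   : length p ≡ suc len
      walk      : IsWalk vertex len
      injective : InjectiveUpTo vertex len
      start     : vertex 0 ≡ u
      end       : vertex len ≡ v
      within    : ∀ l → l ≤ len → vertex l ∈ S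

  indexing : ∀ {S u v p} → IsPath G S u v p → Indexing S u v p
  indexing {p = []} path with IsPath.start path
  ... | ()
  indexing {p = x ∷ xs} path with IsPath.start path
  ... | refl = record
    { vertex = at x xs ; len = length xs ; length≡ = refl
    ; walk = at-linked (IsPath.linked path)
    ; injective = at-injective (IsPath.unique path)
    ; start = at-zero x xs
    ; end = just-injective (trans (sym (at-last x xs)) (IsPath.end path))
    ; within = λ l _ → at-all (IsPath.inS path) l }

  path-between-≤ : ∀ {S h T} → IsWalk h T → InjectiveUpTo h T → (∀ l → l ≤ T → h l ∈ S) →
                   ∀ {a b} → a ≤ b → b ≤ T → ∃ λ p → IsPath G S (h a) (h b) p
  path-between-≤ {S} {h} {T} walk inj within {a} {b} a≤b b≤T =
    _ , subst₂ (λ x y → IsPath G S x y (pathList (λ l → h (a + l)) (b ∸ a))) (cong h (+-identityʳ a)) (cong h a+[b∸a]≡b)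
          (isPath-pathList (isWalk-shift walk a le) (injectiveUpTo-shift inj a le)
                           (λ l l≤ → within (a + l) (≤-trans (+-monoʳ-≤ a l≤) le)))
    where
    a+[b∸a]≡b = m+[n∸m]≡n a≤b
    le : a + (b ∸ a) ≤ T
    le = subst (_≤ T) (sym a+[b∸a]≡b) b≤T

  image-connected : ∀ {h T} → IsWalk h T → InjectiveUpTo h T → Connected G (image h T)
  image-connected {h} {T} walk inj = (h 0 , ∈-image h T z≤n) , λ u v u∈ v∈ → between (image-occurs h T u∈) (image-occurs h T v∈)
    where
    within : ∀ l → l ≤ T → h l ∈ image h T
    within l = ∈-image h T
    between : ∀ {u v} → Occurs h T u → Occurs h T v → ∃ λ p → IsPath G (image h T) u v p
    between (a , a≤ , refl) (b , b≤ , refl) with ≤-<-connex a b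
    ... | inj₁ a≤b = path-between-≤ walk inj within a≤b b≤
    ... | inj₂ b<a = subst₂ (λ x y → ∃ λ p → IsPath G (image h T) x y p) (cong h (m∸[m∸n]≡n a≤)) (cong h (m∸[m∸n]≡n b≤))
                       (path-between-≤ (isWalk-reverse walk) (injectiveUpTo-reverse inj)
                         (λ l _ → within (T ∸ l) (m∸n≤m T l)) (∸-monoʳ-≤ T (<⇒≤ b<a)) (m∸n≤m T b))

  IsChordless : (ℕ → Fin n) → ℕ → Set
  IsChordless q t = ∀ l l' → l ≤ t → l' ≤ t → Adj (q l) (q l') → l' ≡ suc l ⊎ l ≡ suc l'

  record IsInducedPath (q : ℕ → Fin n) (t : ℕ) : Set where
    field
      walk      : IsWalk q t
      injective : InjectiveUpTo q t
      chordless : IsChordless q t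

  isInducedPath-shift : ∀ {q t} → IsInducedPath q t → ∀ a {t'} → a + t' ≤ t → IsInducedPath (λ l → q (a + l)) t'
  isInducedPath-shift {q} path a le = record
    { walk      = isWalk-shift walk a le
    ; injective = injectiveUpTo-shift injective a le
    ; chordless = λ l l' l≤ l'≤ e → cancel (chordless (a + l) (a + l') (≤-trans (+-monoʳ-≤ a l≤) le) (≤-trans (+-monoʳ-≤ a l'≤) le) e)
    }
    where
    open IsInducedPath path
    cancel : ∀ {l l'} → a + l' ≡ suc (a + l) ⊎ a + l ≡ suc (a + l') → l' ≡ suc l ⊎ l ≡ suc l'
    cancel {l} {l'} (inj₁ e) = inj₁ (+-cancelˡ-≡ a l' (suc l) (trans e (sym (+-suc a l))))
    cancel {l} {l'} (inj₂ e) = inj₂ (+-cancelˡ-≡ a l (suc l') (trans e (sym (+-suc a l'))))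

  isInducedPath-reverse : ∀ {q t} → IsInducedPath q t → IsInducedPath (λ l → q (t ∸ l)) t
  isInducedPath-reverse {q} {t} path = record
    { walk      = isWalk-reverse walk
    ; injective = injectiveUpTo-reverse injective
    ; chordless = λ l l' l≤ l'≤ e → swap l l' l≤ l'≤ (chordless (t ∸ l) (t ∸ l') (m∸n≤m t l) (m∸n≤m t l') e)
    }
    where
    open IsInducedPath path
    step : ∀ l l' → l ≤ t → l' ≤ t → t ∸ l' ≡ suc (t ∸ l) → l ≡ suc l'
    step zero    l' _  l'≤ e = ⊥-elim (<⇒≱ (s≤s ≤-refl) (≤-trans (≤-reflexive (sym e)) (m∸n≤m t l')))
    step (suc l) l' l≤ l'≤ e = cong suc (sym (∸-cancelˡ-≡ l'≤ (≤-trans (n≤1+n l) l≤) (trans e (sym (+-∸-assoc 1 l≤)))))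
    swap : ∀ l l' → l ≤ t → l' ≤ t → t ∸ l' ≡ suc (t ∸ l) ⊎ t ∸ l ≡ suc (t ∸ l') → l' ≡ suc l ⊎ l ≡ suc l'
    swap l l' l≤ l'≤ (inj₁ e) = inj₂ (step l l' l≤ l'≤ e)
    swap l l' l≤ l'≤ (inj₂ e) = inj₁ (step l' l l'≤ l≤ e)

  isInducedPath-glue : ∀ {f g a b} → IsInducedPath f a → IsInducedPath g b → Adj (f a) (g 0) →
                       (∀ l l' → l ≤ a → l' ≤ b → f l ≢ g l') →
                       (∀ l l' → l ≤ a → l' ≤ b → Adj (f l) (g l') → l ≡ a × l' ≡ 0) →
                       IsInducedPath (glue f a g) (a + suc b)
  isInducedPath-glue {f} {g} {a} {b} path-f path-g bridge disjoint only-bridge = record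
    { walk      = isWalk-glue (IsInducedPath.walk path-f) (IsInducedPath.walk path-g) bridge
    ; injective = injectiveUpTo-glue (IsInducedPath.injective path-f) (IsInducedPath.injective path-g) disjoint
    ; chordless = chordless
    }
    where
    after-bridge : ∀ {l} → a < l → l ∸ suc a ≡ 0 → l ≡ suc a
    after-bridge a<l e = ≤-antisym (m∸n≡0⇒m≤n e) a<l
    chordless : IsChordless (glue f a g) (a + suc b)
    chordless l l' l≤ l'≤ e with ≤-<-connex l a | ≤-<-connex l' a
    ... | inj₁ p | inj₁ q = IsInducedPath.chordless path-f l l' p q e
    ... | inj₂ p | inj₂ q with IsInducedPath.chordless path-g _ _ (glue-index a b p l≤) (glue-index a b q l'≤) e
    ...   | inj₁ e' = inj₁ (∸-cancelʳ-≡ q (≤-trans p (n≤1+n l)) (trans e' (sym (+-∸-assoc 1 p))))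
    ...   | inj₂ e' = inj₂ (∸-cancelʳ-≡ p (≤-trans q (n≤1+n l')) (trans e' (sym (+-∸-assoc 1 q))))
    chordless l l' l≤ l'≤ e | inj₁ p | inj₂ q with only-bridge l (l' ∸ suc a) p (glue-index a b q l'≤) e
    ... | refl , e' = inj₁ (after-bridge q e')
    chordless l l' l≤ l'≤ e | inj₂ p | inj₁ q with only-bridge l' (l ∸ suc a) q (glue-index a b p l≤) (Adj-sym e)
    ... | refl , e' = inj₂ (after-bridge p e')

  record IsCycle (c : ℕ → Fin n) (M : ℕ) : Set where
    field
      injective : InjectiveUpTo c M
      adjacent  : ∀ l → l ≤ M → Adj (c l) (c (next M l))

  record IsInducedCycle (c : ℕ → Fin n) (M : ℕ) : Set where
    field
      isCycle   : IsCycle c M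
      chordless : ∀ l l' → l ≤ M → l' ≤ M → Adj (c l) (c l') → CyclicallyAdjacent M l l'
    open IsCycle isCycle public

  isCycle⇒isWalk : ∀ {c M} → IsCycle c M → IsWalk c M
  isCycle⇒isWalk {c} cycle l l< = subst (λ z → Adj (c l) (c z)) (next-< l<) (IsCycle.adjacent cycle l (<⇒≤ l<))

  isCycle-rotate : ∀ {c M} → IsCycle c M → ∀ {p} (p≤M : p ≤ M) → IsCycle (c ∘ Rotation.rotate M p p≤M) M
  isCycle-rotate {c} {M} cycle p≤M = record
    { injective = λ l l' l≤ l'≤ e → rotate-injective l≤ l'≤ (injective _ _ (rotate-≤ l) (rotate-≤ l') e)
    ; adjacent  = λ l _ → subst (λ z → Adj (c (rotate l)) (c z)) (sym (rotate-next l)) (adjacent (rotate l) (rotate-≤ l))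
    }
    where
    open IsCycle cycle
    open Rotation M _ p≤M

  isInducedCycle-rotate : ∀ {c M} → IsInducedCycle c M → ∀ {p} (p≤M : p ≤ M) →
                          IsInducedCycle (c ∘ Rotation.rotate M p p≤M) M
  isInducedCycle-rotate {c} {M} cycle p≤M = record
    { isCycle   = isCycle-rotate isCycle p≤M
    ; chordless = λ l l' l≤ l'≤ e → cyclicallyAdjacent-unrotate M p≤M l≤ l'≤ (chordless _ _ (rotate-≤ l) (rotate-≤ l') e)
    }
    where
    open IsInducedCycle cycle
    open Rotation M _ p≤M

  isInducedCycle⇒isInducedPath : ∀ {c t} → IsInducedCycle c (suc t) → IsInducedPath (c ∘ suc) t
  isInducedCycle⇒isInducedPath {c} {t} cycle = record
    { walk      = λ l l< → subst (λ z → Adj (c (suc l)) (c z)) (next-< (s≤s l<)) (adjacent (suc l) (s≤s (<⇒≤ l<)))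
    ; injective = λ l l' l≤ l'≤ e → suc-injective (injective _ _ (s≤s l≤) (s≤s l'≤) e)
    ; chordless = λ l l' l≤ l'≤ e → drop-suc l l' l≤ l'≤ (chordless (suc l) (suc l') (s≤s l≤) (s≤s l'≤) e)
    }
    where
    open IsInducedCycle cycle
    next-suc : ∀ {l l'} → l ≤ t → suc l' ≡ next (suc t) (suc l) → l' ≡ suc l
    next-suc {l} l≤ e with m≤n⇒m<n∨m≡n l≤
    ... | inj₁ l<t  = suc-injective (trans e (next-< (s≤s l<t)))
    ... | inj₂ refl = ⊥-elim (1+n≢0 (trans e (next-last (suc t))))
    drop-suc : ∀ l l' → l ≤ t → l' ≤ t → CyclicallyAdjacent (suc t) (suc l) (suc l') → l' ≡ suc l ⊎ l ≡ suc l'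
    drop-suc l l' l≤ _ (inj₁ e) = inj₁ (next-suc l≤ e)
    drop-suc l l' _ l'≤ (inj₂ e) = inj₂ (next-suc l'≤ e)

  isPath? : ∀ S u v p → Dec (IsPath G S u v p)
  isPath? S u v p = map′ (λ (s , e , i , l , q) → record { start = s ; end = e ; inS = i ; linked = l ; unique = q })
                         (λ path → IsPath.start path , IsPath.end path , IsPath.inS path , IsPath.linked path , IsPath.unique path)
                         (≡-dec _≟ᶠ_ (head p) (just u) ×-dec ≡-dec _≟ᶠ_ (last p) (just v) ×-dec
                          All.all? (_∈? S) p ×-dec linked? adj? p ×-dec Unique.unique? _≟ᶠ_ p)

  -- Paths have no repeated vertices, so it suffices to search the lists of length at most n.
  path? : ∀ S u v → Dec (∃ λ p → IsPath G S u v p)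
  path? S u v with shortList? n (isPath? S u v)
  ... | yes (p , _ , path) = yes (p , path)
  ... | no ¬p = no λ (p , path) → ¬p (p , unique-length≤ p (IsPath.unique path) , path)

  connected-minus : ∀ {B} → Biconnected G B → ∀ {w x} → w ∈ B → x ∈ B → x ≢ w → Connected G (B - w)
  connected-minus {B} ((_ , connect) , no-cut) {w} {x} w∈ x∈ x≢w = (x , x∈p∧x≢y⇒x∈p-y x∈ x≢w) , connect-minus
    where
    connect-minus : ∀ u v → u ∈ B - w → v ∈ B - w → ∃ λ p → IsPath G (B - w) u v p
    connect-minus u v u∈ v∈ with path? (B - w) u v
    ... | yes p = p
    ... | no ¬p = ⊥-elim (no-cut w (w∈ , u , v , proj₁ (∈-minus u∈) , proj₁ (∈-minus v∈) ,
                                    proj₂ (∈-minus u∈) , proj₂ (∈-minus v∈) ,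
                                    connect u v (proj₁ (∈-minus u∈)) (proj₁ (∈-minus v∈)) , ¬p))

  Lipschitz : Subset n → (Fin n → ℕ) → Set
  Lipschitz S d = ∀ {x y} → x ∈ S → y ∈ S → Adj x y → d y ≤ suc (d x)

  lipschitz-walk : ∀ {S d} → Lipschitz S d → ∀ x xs {v} → All (_∈ S) (x ∷ xs) → Linked Adj (x ∷ xs) →
                   last (x ∷ xs) ≡ just v → d v ≤ d x + length xs
  lipschitz-walk {d = d} lip x []       _                 _         refl = ≤-reflexive (sym (+-identityʳ (d x)))
  lipschitz-walk {d = d} lip x (y ∷ ys) (x∈ ∷ y∈ ∷ ys∈) (xy ∷ ys~) eq = begin
    _                       ≤⟨ lipschitz-walk lip y ys (y∈ ∷ ys∈) ys~ eq ⟩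
    d y + length ys         ≤⟨ +-monoˡ-≤ (length ys) (lip x∈ y∈ xy) ⟩
    suc (d x) + length ys   ≡⟨ +-suc (d x) (length ys) ⟨
    d x + length (y ∷ ys)   ∎
    where open ≤-Reasoning

  lipschitz-length : ∀ {S d u v p} → Lipschitz S d → IsPath G S u v p → suc (d v) ≤ d u + length p
  lipschitz-length {p = []} _ path with IsPath.start path
  ... | ()
  lipschitz-length {d = d} {p = x ∷ xs} lip path with IsPath.start path
  ... | refl = ≤-trans (s≤s (lipschitz-walk lip x xs (IsPath.inS path) (IsPath.linked path) (IsPath.end path)))
                       (≤-reflexive (sym (+-suc (d x) (length xs))))

  isGeodesic-by-potential : ∀ {S d u v p} → Lipschitz S d → d u ≡ 0 → IsPath G S u v p → length p ≤ suc (d v) →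
                            IsGeodesic G S u v p
  isGeodesic-by-potential {d = d} {u} {v} {p} lip du≡0 path p≤ =
    path , λ q path-q → ≤-trans p≤ (subst (λ x → suc (d v) ≤ x + length q) du≡0 (lipschitz-length lip path-q))

  LevelChords : (ℕ → Fin n) → ℕ → ℕ → Set
  LevelChords h K M = ∀ l l' → l ≤ M → l' ≤ M → Adj (h l) (h l') →
                      CyclicallyAdjacent M l l' ⊎ cycleDistance K l ≡ cycleDistance K l'

  cycleDistance-lipschitz : ∀ {h K M} → suc M ≡ K + K → K < M → InjectiveUpTo h M → LevelChords h K M →
                            Lipschitz (image h M) (cycleDistance K ∘ index h M)
  cycleDistance-lipschitz {h} {K} {M} M≡ K<M inj chords x∈ y∈ x~y with image-occurs h M x∈ | image-occurs h M y∈
  ... | l , l≤ , refl | l' , l'≤ , refl =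
    subst₂ (λ a b → b ≤ suc a) (sym (distance-h l≤)) (sym (distance-h l'≤)) (step (chords l l' l≤ l'≤ x~y))
    where
    distance-h : ∀ {l} → l ≤ M → cycleDistance K (index h M (h l)) ≡ cycleDistance K l
    distance-h l≤ = cong (cycleDistance K) (index-correct h M inj l≤)
    step : CyclicallyAdjacent M l l' ⊎ cycleDistance K l ≡ cycleDistance K l' → cycleDistance K l' ≤ suc (cycleDistance K l)
    step (inj₁ (inj₁ refl)) = proj₁ (cycleDistance-next M≡ K<M l≤)
    step (inj₁ (inj₂ refl)) = proj₂ (cycleDistance-next M≡ K<M l'≤)
    step (inj₂ e)           = ≤-trans (≤-reflexive (sym e)) (n≤1+n _)

  pathList-second : ∀ {f g T} → pathList f (suc T) ≡ pathList g (suc T) → f 1 ≡ g 1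
  pathList-second {f} = cong λ { (_ ∷ y ∷ _) → y ; _ → f 1 }

  OffPath : Fin n → (ℕ → Fin n) → ℕ → Set
  OffPath w q t = ∀ l → l ≤ t → q l ≢ w

  NoNeighbourBetween : Fin n → (ℕ → Fin n) → ℕ → ℕ → Set
  NoNeighbourBetween w q a b = ∀ l → a < l → l < b → ¬ Adj w (q l)

  ApexChord : Fin n → (ℕ → Fin n) → ℕ → ℕ → ℕ → Set
  ApexChord w f D a b = ∃ λ l → 0 < l × l < D × Adj w (f l) × (a ≡ 0 × b ≡ suc l ⊎ a ≡ suc l × b ≡ 0)

  module _ {w f D} (path : IsInducedPath f D) (off : OffPath w f D) (w~start : Adj w (f 0)) (w~end : Adj w (f D)) where
    open IsInducedPath path

    isCycle-cons : IsCycle (cons w f) (suc D)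
    isCycle-cons = record { injective = inj ; adjacent = adj }
      where
      inj : InjectiveUpTo (cons w f) (suc D)
      inj zero    zero     _   _    _ = refl
      inj zero    (suc l') _   l'≤ e = ⊥-elim (off l' (≤-pred l'≤) (sym e))
      inj (suc l) zero     l≤  _   e = ⊥-elim (off l (≤-pred l≤) e)
      inj (suc l) (suc l') l≤  l'≤ e = cong suc (injective l l' (≤-pred l≤) (≤-pred l'≤) e)
      adj : ∀ l → l ≤ suc D → Adj (cons w f l) (cons w f (next (suc D) l))
      adj zero _ rewrite next-< {suc D} {0} (s≤s z≤n) = w~start
      adj (suc l) l≤ with m≤n⇒m<n∨m≡n (≤-pred l≤)
      ... | inj₁ l<D  rewrite next-< (s≤s l<D) = walk l l<D
      ... | inj₂ refl rewrite next-last (suc D) = Adj-sym w~end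

    cons-chord : ∀ {a b} → a ≤ suc D → b ≤ suc D → Adj (cons w f a) (cons w f b) →
                 CyclicallyAdjacent (suc D) a b ⊎ ApexChord w f D a b
    cons-chord {zero} {zero} _ _ e = ⊥-elim (irrefl e)
    cons-chord {zero} {suc l} _ l≤ e with endpoint-or-interior (≤-pred l≤)
    ... | inj₁ refl                = inj₁ (inj₁ (sym (next-< {suc D} (s≤s z≤n))))
    ... | inj₂ (inj₁ refl)         = inj₁ (inj₂ (sym (next-last (suc D))))
    ... | inj₂ (inj₂ (0<l , l<D))  = inj₂ (l , 0<l , l<D , e , inj₁ (refl , refl))
    cons-chord {suc l} {zero} l≤ _ e with endpoint-or-interior (≤-pred l≤)
    ... | inj₁ refl                = inj₁ (inj₂ (sym (next-< {suc D} (s≤s z≤n))))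
    ... | inj₂ (inj₁ refl)         = inj₁ (inj₁ (sym (next-last (suc D))))
    ... | inj₂ (inj₂ (0<l , l<D))  = inj₂ (l , 0<l , l<D , Adj-sym e , inj₂ (refl , refl))
    cons-chord {suc l} {suc l'} l≤ l'≤ e with chordless l l' (≤-pred l≤) (≤-pred l'≤) e
    ... | inj₁ refl = inj₁ (inj₁ (sym (next-< (s≤s (≤-pred l'≤)))))
    ... | inj₂ refl = inj₁ (inj₂ (sym (next-< (s≤s (≤-pred l≤)))))

  geodesic-no-shortcut : ∀ {S u v p} → IsGeodesic G S u v p → (ix : Indexing S u v p) → let open Indexing ix in
                         ∀ {l l'} → suc (suc l) ≤ l' → l' ≤ len → ¬ Adj (vertex l) (vertex l')
  geodesic-no-shortcut {S} {u} {v} {p} (_ , shortest) ix {l} {l'} 2+l≤l' l'≤T q~q' = <⇒≱ shorter (shortest _ shortcut-path)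
    where
    open Indexing ix renaming (vertex to q; len to T)
    b = T ∸ l'
    l'+b≡T : l' + b ≡ T
    l'+b≡T = m+[n∸m]≡n l'≤T
    l<l' : l < l'
    l<l' = <-trans (n<1+n l) 2+l≤l'
    l≤T = ≤-trans (<⇒≤ l<l') l'≤T
    rest : ℕ → Fin n
    rest m = q (l' + m)
    h = glue q l rest
    disjoint : ∀ m m' → m ≤ l → m' ≤ b → q m ≢ rest m'
    disjoint m m' m≤l m'≤b e = <⇒≢ (<-≤-trans (≤-<-trans m≤l l<l') (m≤m+n l' m'))
      (injective m (l' + m') (≤-trans m≤l l≤T) (≤-trans (+-monoʳ-≤ l' m'≤b) (≤-reflexive l'+b≡T)) e)
    within-h : ∀ m → m ≤ l + suc b → h m ∈ S
    within-h m m≤ with ≤-<-connex m l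
    ... | inj₁ m≤l = within m (≤-trans m≤l l≤T)
    ... | inj₂ l<m = within (l' + (m ∸ suc l)) (≤-trans (+-monoʳ-≤ l' (glue-index l b l<m m≤)) (≤-reflexive l'+b≡T))
    shortcut-path : IsPath G S u v (pathList h (l + suc b))
    shortcut-path = subst₂ (λ x y → IsPath G S x y (pathList h (l + suc b)))
      (trans (glue-≤ q l rest z≤n) start) (trans (glue-end q l rest b) (trans (cong q l'+b≡T) end))
      (isPath-pathList (isWalk-glue (isWalk-≤ walk l≤T) (isWalk-shift walk l' (≤-reflexive l'+b≡T))
                                    (subst (Adj (q l) ∘ q) (sym (+-identityʳ l')) q~q'))
                       (injectiveUpTo-glue (injectiveUpTo-≤ injective l≤T) (injectiveUpTo-shift injective l' (≤-reflexive l'+b≡T)) disjoint)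
                       within-h)
    shorter : length (pathList h (l + suc b)) < length p
    shorter = subst₂ _<_ (sym (length-applyUpTo h (suc (l + suc b)))) (sym length≡) (s≤s (begin-strict
      l + suc b  ≡⟨ +-suc l b ⟩
      suc l + b  <⟨ +-monoˡ-< b 2+l≤l' ⟩
      l' + b     ≡⟨ l'+b≡T ⟩
      T          ∎))
      where open ≤-Reasoning

  geodesic-inducedPath : ∀ {S u v p} → IsGeodesic G S u v p → (ix : Indexing S u v p) →
                         IsInducedPath (Indexing.vertex ix) (Indexing.len ix)
  geodesic-inducedPath geodesic ix = record { walk = walk ; injective = injective ; chordless = chordless }
    where
    open Indexing ix renaming (vertex to q; len to T)
    no-shortcut = geodesic-no-shortcut geodesic ix
    chordless : IsChordless q T
    chordless l l' l≤ l'≤ e with <-cmp l l'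
    ... | tri≈ _ refl _ = ⊥-elim (irrefl e)
    ... | tri< l<l' _ _ with suc l ≟ l'
    ...   | yes sl≡l' = inj₁ (sym sl≡l')
    ...   | no sl≢l'  = ⊥-elim (no-shortcut (≤∧≢⇒< l<l' sl≢l') l'≤ e)
    chordless l l' l≤ l'≤ e | tri> _ _ l'<l with suc l' ≟ l
    ...   | yes sl'≡l = inj₂ (sym sl'≡l)
    ...   | no sl'≢l  = ⊥-elim (no-shortcut (≤∧≢⇒< l'<l sl'≢l) l≤ (Adj-sym e))

  -- Hereditarily geodetic graphs

  module _ (hg : HereditarilyGeodetic G) where

    -- Both halves of the cycle from h 0 to h K are geodesics of the induced subgraph, witnessed by the
    -- distance from h 0 along the cycle, which level chords do not shorten.
    no-even-cycle-with-level-chords :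
      ∀ {h K M} → 2 ≤ K → suc M ≡ K + K → IsCycle h M → LevelChords h K M → ⊥
    no-even-cycle-with-level-chords {h} {K@(suc K-1)} {M} 2≤K M≡ cycle chords =
      <⇒≢ (≤-trans 2≤K (<⇒≤ K<M)) (injective 1 M 1≤M ≤-refl (trans first-steps-agree (cong h rotate[K-1]≡M)))
      where
      open IsCycle cycle
      open Rotation M K
      K<M : K < M
      K<M = ≤-pred (subst (suc (suc K) ≤_) (sym M≡) (subst (_≤ K + K) (+-comm K 2) (+-monoʳ-≤ K 2≤K)))
      K≤M = <⇒≤ K<M
      1≤M = ≤-trans (s≤s z≤n) K≤M
      ρ = rotate K≤M
      rotate[K-1]≡M : ρ K-1 ≡ M
      rotate[K-1]≡M = trans (cong (_% suc M) (trans (sym (+-∸-comm K (s≤s z≤n))) (cong (_∸ 1) (sym M≡)))) (m≤n⇒m%n≡m ≤-refl)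
      S = image h M
      walk = isCycle⇒isWalk cycle
      -- the second half, traversed from h 0 = h (K + K) down to h K
      g : ℕ → Fin n
      g l = h (ρ (K ∸ l))
      g-start : g 0 ≡ h 0
      g-start = cong h (trans (cong (_% suc M) (sym M≡)) (n%n≡0 (suc M)))
      g-end : g K ≡ h K
      g-end = cong h (trans (cong ρ (n∸n≡0 K)) (rotate-zero K≤M))
      rotated = isCycle-rotate cycle K≤M
      path₁ : IsPath G S (h 0) (h K) (pathList h K)
      path₁ = isPath-pathList (isWalk-≤ walk K≤M) (injectiveUpTo-≤ injective K≤M) (λ l l≤ → ∈-image h M (≤-trans l≤ K≤M))
      path₂ : IsPath G S (h 0) (h K) (pathList g K)
      path₂ = subst₂ (λ x y → IsPath G S x y (pathList g K)) g-start g-end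
                (isPath-pathList (isWalk-reverse (isWalk-≤ (isCycle⇒isWalk rotated) K≤M))
                                 (injectiveUpTo-reverse (injectiveUpTo-≤ (IsCycle.injective rotated) K≤M))
                                 (λ l _ → ∈-image h M (rotate-≤ K≤M (K ∸ l))))
      d : Fin n → ℕ
      d = cycleDistance K ∘ index h M
      d-h : ∀ {l} → l ≤ M → d (h l) ≡ cycleDistance K l
      d-h l≤ = cong (cycleDistance K) (index-correct h M injective l≤)
      lipschitz : Lipschitz S d
      lipschitz = cycleDistance-lipschitz M≡ K<M injective chords
      d-start : d (h 0) ≡ 0
      d-start = trans (d-h z≤n) (cycleDistance-≤ {K} z≤n)
      d-end : d (h K) ≡ K
      d-end = trans (d-h K≤M) (cycleDistance-≤ ≤-refl)
      geodesic : ∀ {f} → IsPath G S (h 0) (h K) (pathList f K) → IsGeodesic G S (h 0) (h K) (pathList f K)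
      geodesic {f} path = isGeodesic-by-potential {d = d} lipschitz d-start path
                            (≤-reflexive (trans (length-applyUpTo f (suc K)) (cong suc (sym d-end))))
      first-steps-agree : h 1 ≡ g 1
      first-steps-agree = pathList-second {h} {g} {K-1} (proj₂ (hg S (image-connected walk injective) (h 0) (h K) (∈-image h M z≤n) (∈-image h M K≤M))
                                             (pathList h K) (pathList g K) (geodesic {h} path₁) (geodesic {g} path₂))

    -- Closing the segment of q from i to i + D by w gives an even cycle. Rotated to start at its vertex of
    -- index c (counting w as index 0), the only possible chord, from w to index c + c, becomes a level chord.
    no-fan-cycle : ∀ {q t w} → IsInducedPath q t → OffPath w q t → ∀ i {D K c} → i + D ≤ t →
                   2 ≤ K → suc (suc D) ≡ K + K → 0 < c → c < K →
                   Adj w (q i) → Adj w (q (i + D)) →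
                   (∀ l → 0 < l → l < D → Adj w (q (i + l)) → suc l ≡ c + c) → ⊥
    no-fan-cycle {q} {t} {w} path off i {D} {K} {c} i+D≤t 2≤K D≡ 0<c c<K w~start w~end interior =
      no-even-cycle-with-level-chords 2≤K D≡ (isCycle-rotate cycle c≤M) level-chords
      where
      M = suc D
      f : ℕ → Fin n
      f l = q (i + l)
      f-path = isInducedPath-shift path i i+D≤t
      f-off : OffPath w f D
      f-off l l≤ = off (i + l) (≤-trans (+-monoʳ-≤ i l≤) i+D≤t)
      w~f0 : Adj w (f 0)
      w~f0 = subst (λ z → Adj w (q z)) (sym (+-identityʳ i)) w~start
      cycle = isCycle-cons f-path f-off w~f0 w~end
      open FanChord D≡ c<K
      open Rotation M c c≤M
      at-chord : ∀ {l m} → l ≤ M → rotate l ≡ suc m → 0 < m → m < D → Adj w (f m) → cycleDistance K l ≡ c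
      at-chord l≤ e 0<m m<D w~fm = rotate≡c+c⇒distance≡ l≤ (trans e (interior _ 0<m m<D w~fm))
      level-chords : LevelChords (cons w f ∘ rotate) K M
      level-chords l l' l≤ l'≤ e with cons-chord f-path f-off w~f0 w~end (rotate-≤ l) (rotate-≤ l') e
      ... | inj₁ adjacent = inj₁ (cyclicallyAdjacent-unrotate M c≤M l≤ l'≤ adjacent)
      ... | inj₂ (m , 0<m , m<D , w~fm , inj₁ (ρl≡0 , ρl'≡)) =
        inj₂ (trans (rotate≡0⇒distance≡ 0<c l≤ ρl≡0) (sym (at-chord l'≤ ρl'≡ 0<m m<D w~fm)))
      ... | inj₂ (m , 0<m , m<D , w~fm , inj₂ (ρl≡ , ρl'≡0)) =
        inj₂ (trans (at-chord l≤ ρl≡ 0<m m<D w~fm) (sym (rotate≡0⇒distance≡ 0<c l'≤ ρl'≡0)))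

    module _ {q t w} (path : IsInducedPath q t) (off : OffPath w q t) where

      consecutive-neighbours-odd : ∀ {i j} → i < j → j ≤ t → Adj w (q i) → Adj w (q j) →
                                   NoNeighbourBetween w q i j → ∃ λ s → j ≡ i + suc (s + s)
      consecutive-neighbours-odd {i} i<j j≤t w~i w~j gap with m≤n⇒∃[o]m+o≡n (<⇒≤ i<j)
      ... | g , refl with even-or-odd g
      ...   | s , inj₂ refl = s , refl
      ...   | zero , inj₁ refl = ⊥-elim (<⇒≢ i<j (sym (+-identityʳ i)))
      ...   | suc s , inj₁ refl =
        ⊥-elim (no-fan-cycle path off i j≤t (s≤s (s≤s z≤n)) (cong suc (sym (+-suc (suc s) (suc s))))
                             (s≤s z≤n) (s≤s (s≤s z≤n)) w~i w~j
                             λ l 0<l l< w~ → ⊥-elim (gap (i + l) (m<m+n i 0<l) (+-monoʳ-< i l<) w~))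

      no-odd-odd-fan : ∀ {i a b} → i + (suc (a + a) + suc (b + b)) ≤ t →
                       Adj w (q i) → Adj w (q (i + suc (a + a))) → Adj w (q (i + (suc (a + a) + suc (b + b)))) →
                       NoNeighbourBetween w q i (i + suc (a + a)) →
                       NoNeighbourBetween w q (i + suc (a + a)) (i + (suc (a + a) + suc (b + b))) → ⊥
      no-odd-odd-fan {i} {a} {b} ≤t w~i w~j w~k gap₁ gap₂ =
        no-fan-cycle path off i ≤t (s≤s (s≤s z≤n)) (2+odd+odd≡double a b) (s≤s z≤n) (s≤s (s≤s (m≤m+n a b))) w~i w~k interior
        where
        interior : ∀ l → 0 < l → l < suc (a + a) + suc (b + b) → Adj w (q (i + l)) → suc l ≡ suc a + suc a
        interior l 0<l l< w~ with <-cmp l (suc (a + a))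
        ... | tri< l<j _ _ = ⊥-elim (gap₁ (i + l) (m<m+n i 0<l) (+-monoʳ-< i l<j) w~)
        ... | tri≈ _ refl _ = cong suc (sym (+-suc a a))
        ... | tri> _ _ j<l = ⊥-elim (gap₂ (i + l) (+-monoʳ-< i j<l) (+-monoʳ-< i l<) w~)

      no-three-neighbours : ∀ {i j k} → i < j → j < k → k ≤ t → Adj w (q i) → Adj w (q j) → Adj w (q k) → ⊥
      no-three-neighbours {i} {j} {k} i<j j<k k≤t w~i w~j w~k
        with nearest-below (λ l → adj? w (q l)) i<j w~i | nearest-above (λ l → adj? w (q l)) j<k w~k
      ... | i' , _ , i'<j , w~i' , gap₁ | k' , j<k' , k'≤k , w~k' , gap₂
        with consecutive-neighbours-odd i'<j (<⇒≤ (<-≤-trans j<k k≤t)) w~i' w~j gap₁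
      ...   | a , refl with consecutive-neighbours-odd j<k' (≤-trans k'≤k k≤t) w~j w~k' gap₂
      ...     | b , refl = no-odd-odd-fan {i'} {a} {b} (subst (_≤ t) assoc (≤-trans k'≤k k≤t)) w~i' w~j
                                          (subst (Adj w ∘ q) assoc w~k') gap₁ (subst (NoNeighbourBetween w q _) assoc gap₂)
        where
        assoc = +-assoc i' (suc (a + a)) (suc (b + b))

      neighbours-at-odd-distance : ∀ {i j} → i < j → j ≤ t → Adj w (q i) → Adj w (q j) → ∃ λ s → j ≡ i + suc (s + s)
      neighbours-at-odd-distance i<j j≤t w~i w~j with nearest-below (λ l → adj? w (q l)) i<j w~i
      ... | i' , i≤i' , i'<j , w~i' , gap with m≤n⇒m<n∨m≡n i≤i'
      ...   | inj₂ refl = consecutive-neighbours-odd i<j j≤t w~i w~j gap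
      ...   | inj₁ i<i' = ⊥-elim (no-three-neighbours i<i' i'<j j≤t w~i w~i' w~j)

      no-three-distinct-neighbours : ∀ {i j k} → i ≢ j → j ≢ k → i ≢ k → i ≤ t → j ≤ t → k ≤ t →
                                     Adj w (q i) → Adj w (q j) → Adj w (q k) → ⊥
      no-three-distinct-neighbours i≢j j≢k i≢k i≤ j≤ k≤ w~i w~j w~k
        with sort3 {Q = λ l → l ≤ t × Adj w (q l)} i≢j j≢k i≢k (i≤ , w~i) (j≤ , w~j) (k≤ , w~k)
      ... | _ , _ , _ , a<b , b<c , (_ , w~a) , (_ , w~b) , (c≤ , w~c) = no-three-neighbours a<b b<c c≤ w~a w~b w~c

    module Ear {c t e j δ} (cycle : IsInducedCycle c (suc t)) (ear : IsInducedPath e j)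
               (disjoint : ∀ l p → l ≤ j → p ≤ suc t → e l ≢ c p) (e~c₀ : Adj (e 0) (c 0))
               (δ≤t : δ ≤ t) (e~cδ : Adj (e j) (c (suc δ)))
               (attach : ∀ l p → l ≤ j → p ≤ suc t → Adj (e l) (c p) → p ≡ 0 ⊎ (p ≡ suc δ × l ≡ j)) where
      open IsInducedCycle cycle

      P : ℕ → Fin n
      P l = c (suc l)

      P-path = isInducedCycle⇒isInducedPath cycle

      -- An arc of the cycle without c 0, traversed from c (suc δ) through the indices suc (ι 0), …, suc (ι b).
      record Arc (ι : ℕ → ℕ) (b : ℕ) : Set where
        field
          induced : IsInducedPath (P ∘ ι) b
          bounded : ∀ l → l ≤ b → ι l ≤ t
          starts  : ι 0 ≡ δ
          only-δ  : ∀ {l} → l ≤ b → ι l ≡ δ → l ≡ 0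
          ends-at : Adj (c 0) (P (ι b))

      -- The ear followed by the arc is an induced path avoiding c 0 whose ends are adjacent to c 0.
      arc-length-odd : ∀ {ι b} → Arc ι b → ∃ λ a → j + suc b ≡ suc (a + a)
      arc-length-odd {ι} {b} arc = neighbours-at-odd-distance Q-path Q-off (≤-trans (s≤s z≤n) (m≤n+m (suc b) j)) ≤-refl
                                     (subst (Adj (c 0)) (sym (glue-≤ e j (P ∘ ι) z≤n)) (Adj-sym e~c₀))
                                     (subst (Adj (c 0)) (sym (glue-end e j (P ∘ ι) b)) ends-at)
        where
        open Arc arc
        on-arc : ∀ {l l'} → l ≤ j → l' ≤ b → Adj (e l) (P (ι l')) → l ≡ j × l' ≡ 0
        on-arc {l} {l'} l≤ l'≤ e~ with attach l (suc (ι l')) l≤ (s≤s (bounded l' l'≤)) e~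
        ... | inj₂ (ι≡ , l≡j) = l≡j , only-δ l'≤ (suc-injective ι≡)
        Q-path : IsInducedPath (glue e j (P ∘ ι)) (j + suc b)
        Q-path = isInducedPath-glue ear induced (subst (Adj (e j) ∘ P) (sym starts) e~cδ)
                   (λ l l' l≤ l'≤ → disjoint l (suc (ι l')) l≤ (s≤s (bounded l' l'≤)))
                   (λ l l' l≤ l'≤ → on-arc l≤ l'≤)
        Q-off : OffPath (c 0) (glue e j (P ∘ ι)) (j + suc b)
        Q-off l l≤ with ≤-<-connex l j
        ... | inj₁ l≤j = λ eq → disjoint l 0 l≤j z≤n eq
        ... | inj₂ j<l = λ eq → 1+n≢0 (injective _ 0 (s≤s (bounded _ (glue-index j b j<l l≤))) z≤n eq)

      up-arc : Arc (δ +_) (t ∸ δ)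
      up-arc = record
        { induced = isInducedPath-shift P-path δ (≤-reflexive (m+[n∸m]≡n δ≤t))
        ; bounded = λ l l≤ → ≤-trans (+-monoʳ-≤ δ l≤) (≤-reflexive (m+[n∸m]≡n δ≤t))
        ; starts  = +-identityʳ δ
        ; only-δ  = λ {l} _ e → +-cancelˡ-≡ δ l 0 (trans e (sym (+-identityʳ δ)))
        ; ends-at = subst (λ z → Adj (c 0) (c (suc z))) (sym (m+[n∸m]≡n δ≤t))
                      (Adj-sym (subst (Adj (c (suc t)) ∘ c) (next-last (suc t)) (adjacent (suc t) ≤-refl)))
        }

      down-arc : Arc (δ ∸_) δ
      down-arc = record
        { induced = isInducedPath-reverse (isInducedPath-shift P-path 0 δ≤t)
        ; bounded = λ l _ → ≤-trans (m∸n≤m δ l) δ≤t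
        ; starts  = refl
        ; only-δ  = λ l≤ e → ∸-cancelˡ-≡ l≤ z≤n e
        ; ends-at = subst (λ z → Adj (c 0) (c (suc z))) (sym (n∸n≡0 δ))
                      (subst (Adj (c 0) ∘ c) (next-< {suc t} (s≤s z≤n)) (adjacent 0 z≤n))
        }

    no-odd-cycle-ear : ∀ {c t s} → IsInducedCycle c (suc t) → suc t ≡ s + s →
                       ∀ {e j} → IsInducedPath e j → (∀ l p → l ≤ j → p ≤ suc t → e l ≢ c p) →
                       Adj (e 0) (c 0) → ∀ {δ} → δ ≤ t → Adj (e j) (c (suc δ)) →
                       (∀ l p → l ≤ j → p ≤ suc t → Adj (e l) (c p) → p ≡ 0 ⊎ (p ≡ suc δ × l ≡ j)) → ⊥
    no-odd-cycle-ear {s = s} cycle M≡ ear disjoint e~c₀ δ≤t e~cδ attach =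
      odd-ear-parity {s = s} {a = proj₁ up-odd} {b = proj₁ down-odd} (trans (cong suc (m∸n+n≡m δ≤t)) M≡) (proj₂ up-odd) (proj₂ down-odd)
      where
      open Ear cycle ear disjoint e~c₀ δ≤t e~cδ attach
      up-odd = arc-length-odd up-arc
      down-odd = arc-length-odd down-arc

    module _ {c t y} (cycle : IsInducedCycle c (suc t)) (off : ∀ p → p ≤ suc t → c p ≢ y) where

      -- Removing a cycle vertex that is not a neighbour of y leaves an induced path through all neighbours.
      no-three-neighbours-on-cycle : 2 ≤ t → ∀ {p₁ p₂ p₃} → p₁ ≢ p₂ → p₂ ≢ p₃ → p₁ ≢ p₃ →
                                     p₁ ≤ suc t → p₂ ≤ suc t → p₃ ≤ suc t → Adj y (c p₁) → Adj y (c p₂) → Adj y (c p₃) → ⊥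
      no-three-neighbours-on-cycle 2≤t p₁≢p₂ p₂≢p₃ p₁≢p₃ p₁≤ p₂≤ p₃≤ y~₁ y~₂ y~₃
        with sort3 {Q = λ p → p ≤ suc t × Adj y (c p)} p₁≢p₂ p₂≢p₃ p₁≢p₃ (p₁≤ , y~₁) (p₂≤ , y~₂) (p₃≤ , y~₃)
      ... | i , j , k , i<j , j<k , (i≤ , y~i) , (j≤ , y~j) , (k≤ , y~k) with avoid-three i<j j<k
      ...   | f , f≤3 , f≢i , f≢j , f≢k =
        no-three-distinct-neighbours path path-off (distinct i′ j′ (<⇒≢ i<j)) (distinct j′ k′ (<⇒≢ j<k)) (distinct i′ k′ (<⇒≢ (<-trans i<j j<k)))
          (bound i′) (bound j′) (bound k′) (adj i′ y~i) (adj j′ y~j) (adj k′ y~k)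
        where
        f≤M = ≤-trans f≤3 (s≤s 2≤t)
        open Rotation (suc t) f f≤M
        P = c ∘ rotate ∘ suc
        path = isInducedCycle⇒isInducedPath (isInducedCycle-rotate cycle f≤M)
        path-off : OffPath y P t
        path-off l _ = off (rotate (suc l)) (rotate-≤ (suc l))
        i′ = rotate-preimage i≤ (f≢i ∘ sym)
        j′ = rotate-preimage j≤ (f≢j ∘ sym)
        k′ = rotate-preimage k≤ (f≢k ∘ sym)
        Preimage = λ a → ∃ λ m → m < suc t × rotate (suc m) ≡ a
        bound : ∀ {a} (m : Preimage a) → proj₁ m ≤ t
        bound (_ , m< , _) = ≤-pred m<
        adj : ∀ {a} (m : Preimage a) → Adj y (c a) → Adj y (P (proj₁ m))
        adj (_ , _ , e) y~ = subst (Adj y ∘ c) (sym e) y~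
        distinct : ∀ {a b} (m : Preimage a) (m' : Preimage b) → a ≢ b → proj₁ m ≢ proj₁ m'
        distinct (_ , _ , e) (_ , _ , e') a≢b refl = a≢b (trans (sym e) e')

      no-two-neighbours-on-cycle : 2 ≤ t → ∀ {s} → suc t ≡ s + s → ∀ {p₁ p₂} → p₁ ≢ p₂ → p₁ ≤ suc t → p₂ ≤ suc t →
                                   Adj y (c p₁) → Adj y (c p₂) → ⊥
      no-two-neighbours-on-cycle 2≤t {s} M≡ {p₁} {p₂} p₁≢p₂ p₁≤ p₂≤ y~₁ y~₂ =
        no-odd-cycle-ear {s = s} (isInducedCycle-rotate cycle p₁≤) M≡ single
          (λ _ p _ p≤ e → off (rotate p) (rotate-≤ p) (sym e))
          (subst (Adj y ∘ c) (sym rotate-zero) y~₁) (≤-pred δ<M) (subst (Adj y ∘ c) (sym ρ[1+δ]≡p₂) y~₂) attach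
        where
        open Rotation (suc t) p₁ p₁≤
        preimage = rotate-preimage p₂≤ (p₁≢p₂ ∘ sym)
        δ = proj₁ preimage
        δ<M = proj₁ (proj₂ preimage)
        ρ[1+δ]≡p₂ = proj₂ (proj₂ preimage)
        single : IsInducedPath (λ _ → y) 0
        single = record { walk = λ _ () ; injective = λ { zero zero _ _ _ → refl } ; chordless = λ _ _ _ _ y~y → ⊥-elim (irrefl y~y) }
        attach : ∀ l p → l ≤ 0 → p ≤ suc t → Adj y (c (rotate p)) → p ≡ 0 ⊎ (p ≡ suc δ × l ≡ 0)
        attach l p z≤n p≤ y~ with rotate p ≟ p₁ | rotate p ≟ p₂
        ... | yes e | _     = inj₁ (rotate-injective p≤ z≤n (trans e (sym rotate-zero)))
        ... | no _  | yes e = inj₂ (rotate-injective p≤ δ<M (trans e (sym ρ[1+δ]≡p₂)) , refl)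
        ... | no n₁ | no n₂ = ⊥-elim (no-three-neighbours-on-cycle 2≤t p₁≢p₂ (n₂ ∘ sym) (n₁ ∘ sym) p₁≤ p₂≤ (rotate-≤ p) y~₁ y~₂ y~)

    -- Cutting e at its first vertex adjacent to some c p with p > 0 leaves an ear of the cycle.
    no-return-to-odd-cycle : ∀ {c t s} → IsInducedCycle c (suc t) → 2 ≤ t → suc t ≡ s + s →
                             ∀ {e L} → IsInducedPath e L → (∀ p → p ≤ suc t → c p ≢ e 0) → (∀ l → l < L → e (suc l) ≢ c 0) →
                             Adj (e 0) (c 0) → ∀ {l p} → l ≤ L → p ≤ suc t → 0 < p → Adj (e l) (c p) → ⊥
    no-return-to-odd-cycle {c} {t} {s} cycle 2≤t M≡ {e} {L} path e₀-off e-avoids-c₀ e~c₀ l≤ p≤ 0<p el~cp =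
      from-first (least-witness touches? (_ , l≤ , _ , p≤ , 0<p , el~cp))
      where
      Touches : ℕ → Set
      Touches l = ∃ λ p → p ≤ suc t × 0 < p × Adj (e l) (c p)
      touches? : ∀ l → Dec (Touches l)
      touches? l = anyUpTo≤? (λ p → (0 <? p) ×-dec adj? (e l) (c p)) (suc t)
      from-first : (∃ λ j → j ≤ L × Touches j × (∀ l → l < j → ¬ Touches l)) → ⊥
      from-first (j , j≤L , (zero , _ , () , _) , _)
      from-first (j , j≤L , (suc δ , sδ≤ , _ , ej~δ) , earlier) =
        no-odd-cycle-ear {s = s} cycle M≡ (isInducedPath-shift path 0 j≤L) disjoint e~c₀ (≤-pred sδ≤) ej~δ attach
        where
        disjoint : ∀ l p → l ≤ j → p ≤ suc t → e l ≢ c p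
        disjoint zero    p       _  p≤ eq = e₀-off p p≤ (sym eq)
        disjoint (suc l) zero    l< _  eq = e-avoids-c₀ l (≤-trans l< j≤L) eq
        disjoint (suc l) (suc p) l< p≤ eq = earlier l l< (suc p , p≤ , s≤s z≤n , subst (Adj (e l)) eq (IsInducedPath.walk path l (≤-trans l< j≤L)))
        last-attachment : ∀ p → p ≤ suc t → Adj (e j) (c p) → p ≡ suc δ
        last-attachment p p≤ ej~p with p ≟ suc δ
        ... | yes p≡ = p≡
        ... | no p≢ = ⊥-elim (no-two-neighbours-on-cycle cycle (λ p' p'≤ eq → disjoint j p' ≤-refl p'≤ (sym eq))
                                2≤t {s} M≡ p≢ p≤ sδ≤ ej~p ej~δ)
        attach : ∀ l p → l ≤ j → p ≤ suc t → Adj (e l) (c p) → p ≡ 0 ⊎ (p ≡ suc δ × l ≡ j)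
        attach l p l≤ p≤ el~p with m≤n⇒m<n∨m≡n l≤
        ... | inj₂ refl = inj₂ (last-attachment p p≤ el~p , refl)
        ... | inj₁ l<j with p
        ...   | zero  = inj₁ refl
        ...   | suc p' = ⊥-elim (earlier l l<j (suc p' , p≤ , s≤s z≤n , el~p))

    record LongOddCycle (B : Subset n) : Set where
      field
        c       : ℕ → Fin n
        t s     : ℕ
        induced : IsInducedCycle c (suc t)
        long    : 2 ≤ t
        odd     : suc t ≡ s + s
        ⊆B      : ∀ l → l ≤ suc t → c l ∈ B

    -- Since w has no neighbour on q besides its ends, cons w q is an induced cycle, of odd length by
    -- neighbours-at-odd-distance.
    apex-cycle : ∀ {B w q T} → IsInducedPath q T → OffPath w q T → w ∈ B → (∀ l → l ≤ T → q l ∈ B) →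
                 Adj w (q 0) → Adj w (q T) → ¬ Adj (q 0) (q T) → q 0 ≢ q T → LongOddCycle B
    apex-cycle {B} {w} {q} {T} path off w∈ q∈ w~start w~end start≁end start≢end = record
      { c = cons w q ; t = T ; s = suc (suc (proj₁ odd-length))
      ; induced = record { isCycle = isCycle-cons path off w~start w~end ; chordless = chordless }
      ; long = subst (2 ≤_) (sym (proj₂ odd-length)) (s≤s (s≤s z≤n))
      ; odd = trans (cong suc (proj₂ odd-length)) (cong suc (sym (+-suc (suc (proj₁ odd-length)) (suc (proj₁ odd-length)))))
      ; ⊆B = λ { zero _ → w∈ ; (suc l) l≤ → q∈ l (≤-pred l≤) }
      }
      where
      open IsInducedPath path using (walk)
      0<T : 0 < T
      0<T = n≢0⇒n>0 λ T≡0 → start≢end (cong q (sym T≡0))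
      odd-length : ∃ λ s₁ → T ≡ suc (suc s₁ + suc s₁)
      odd-length with neighbours-at-odd-distance path off 0<T ≤-refl w~start w~end
      ... | zero , T≡1 = ⊥-elim (start≁end (subst (Adj (q 0) ∘ q) (sym T≡1) (walk 0 (subst (0 <_) (sym T≡1) (s≤s z≤n)))))
      ... | suc s₁ , T≡ = s₁ , T≡
      chordless : ∀ a b → a ≤ suc T → b ≤ suc T → Adj (cons w q a) (cons w q b) → CyclicallyAdjacent (suc T) a b
      chordless a b a≤ b≤ e with cons-chord path off w~start w~end a≤ b≤ e
      ... | inj₁ adjacent = adjacent
      ... | inj₂ (l , 0<l , l<T , w~ql , _) = ⊥-elim (no-three-neighbours path off 0<l l<T ≤-refl w~start w~ql w~end)

    module _ {B : Subset n} (bic : Biconnected G B) where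

      induced-P₃ : ∀ {u v} → u ∈ B → v ∈ B → u ≢ v → ¬ Adj u v →
                   ∃ λ x → ∃ λ w → ∃ λ y → x ∈ B × w ∈ B × y ∈ B × Adj x w × Adj w y × ¬ Adj x y × x ≢ y
      induced-P₃ {u} {v} u∈ v∈ u≢v u≁v with proj₁ (hg B (proj₁ bic) u v u∈ v∈)
      ... | p , geodesic = q 0 , q 1 , q 2 , within 0 z≤n , within 1 1≤T , within 2 2≤T , walk 0 1≤T , walk 1 2≤T , x≁y , x≢y
        where
        ix = indexing (proj₁ geodesic)
        open Indexing ix renaming (vertex to q; len to T)
        open IsInducedPath (geodesic-inducedPath geodesic ix) using (chordless)
        2≤T : 2 ≤ T
        2≤T = ≢0∧≢1⇒≥2 (λ T≡0 → u≢v (trans (sym start) (trans (cong q (sym T≡0)) end)))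
                        (λ T≡1 → u≁v (subst₂ Adj start (trans (cong q (sym T≡1)) end) (walk 0 (subst (0 <_) (sym T≡1) (s≤s z≤n)))))
        1≤T = ≤-trans (n≤1+n 1) 2≤T
        x≁y : ¬ Adj (q 0) (q 2)
        x≁y x~y with chordless 0 2 z≤n 2≤T x~y
        ... | inj₁ ()
        ... | inj₂ ()
        x≢y : q 0 ≢ q 2
        x≢y e with injective 0 2 z≤n 2≤T e
        ... | ()

      long-odd-cycle : ∀ {x w y} → x ∈ B → w ∈ B → y ∈ B → Adj x w → Adj w y → ¬ Adj x y → x ≢ y → LongOddCycle B
      long-odd-cycle {x} {w} {y} x∈ w∈ y∈ x~w w~y x≁y x≢y =
        from-geodesic (proj₁ (hg (B - w) (connected-minus bic w∈ x∈ x≢w) x y (x∈p∧x≢y⇒x∈p-y x∈ x≢w) (x∈p∧x≢y⇒x∈p-y y∈ y≢w)))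
        where
        x≢w : x ≢ w
        x≢w refl = irrefl x~w
        y≢w : y ≢ w
        y≢w refl = irrefl w~y
        from-geodesic : (∃ λ p → IsGeodesic G (B - w) x y p) → LongOddCycle B
        from-geodesic (p , geodesic) =
          apex-cycle (geodesic-inducedPath geodesic ix) (λ l l≤ → proj₂ (∈-minus (within l l≤))) w∈
                     (λ l l≤ → proj₁ (∈-minus (within l l≤)))
                     (subst (Adj w) (sym start) (Adj-sym x~w)) (subst (Adj w) (sym end) w~y)
                     (subst₂ (λ a b → ¬ Adj a b) (sym start) (sym end) x≁y) (subst₂ _≢_ (sym start) (sym end) x≢y)
          where
          ix = indexing (proj₁ geodesic)
          open Indexing ix

      module _ (C : LongOddCycle B) where
        open LongOddCycle C

        -- With the cycle rotated so that z attaches at c′ 0, the geodesic from z to c′ 1 avoiding c′ 0 returns to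
        -- the cycle.
        no-attachment : ∀ {z p₀} → z ∈ B → (∀ p → p ≤ suc t → c p ≢ z) → p₀ ≤ suc t → Adj z (c p₀) → ⊥
        no-attachment {z} {p₀} z∈ z-off p₀≤ z~p₀ =
          return (proj₁ (hg (B - c p₀) (connected-minus bic (⊆B p₀ p₀≤) z∈ z≢cp₀) z (c′ 1) (x∈p∧x≢y⇒x∈p-y z∈ z≢cp₀) target∈))
          where
          open Rotation (suc t) p₀ p₀≤
          c′ = c ∘ rotate
          z≢cp₀ : z ≢ c p₀
          z≢cp₀ e = z-off p₀ p₀≤ (sym e)
          target∈ : c′ 1 ∈ B - c p₀
          target∈ = x∈p∧x≢y⇒x∈p-y (⊆B _ (rotate-≤ 1)) λ e →
            1+n≢0 (rotate-injective (s≤s z≤n) z≤n (trans (IsInducedCycle.injective induced _ _ (rotate-≤ 1) p₀≤ e) (sym rotate-zero)))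
          return : (∃ λ p → IsGeodesic G (B - c p₀) z (c′ 1) p) → ⊥
          return (p , geodesic) =
            no-return-to-odd-cycle {s = s} (isInducedCycle-rotate induced p₀≤) long odd (geodesic-inducedPath geodesic ix)
              (λ p p≤ eq → z-off (rotate p) (rotate-≤ p) (trans eq start))
              (λ l l< eq → proj₂ (∈-minus (within (suc l) l<)) (trans eq (cong c rotate-zero)))
              (subst₂ Adj (sym start) (cong c (sym rotate-zero)) z~p₀)
              (m∸n≤m L 1) (s≤s z≤n) (s≤s z≤n) last-touches
            where
            ix = indexing (proj₁ geodesic)
            open Indexing ix renaming (vertex to e; len to L)
            0<L : 0 < L
            0<L = n≢0⇒n>0 λ L≡0 → z-off (rotate 1) (rotate-≤ 1) (sym (trans (sym start) (trans (cong e (sym L≡0)) end)))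
            last-touches : Adj (e (L ∸ 1)) (c′ 1)
            last-touches = subst (Adj (e (L ∸ 1))) (trans (cong e (m+[n∸m]≡n 0<L)) end)
                                 (walk (L ∸ 1) (≤-reflexive (m+[n∸m]≡n 0<L)))

        covers : ∀ {v} → v ∈ B → Occurs c (suc t) v
        covers {v} v∈ with occurs? c (suc t) v
        ... | yes on = on
        ... | no not-on = ⊥-elim (reach (proj₂ (proj₁ bic) v (c 0) v∈ (⊆B 0 z≤n)))
          where
          reach : (∃ λ p → IsPath G B v (c 0) p) → ⊥
          reach (p , path) = from-first (least-witness (λ l → occurs? c (suc t) (f l)) (T , ≤-refl , 0 , z≤n , sym end))
            where
            open Indexing (indexing path) renaming (vertex to f; len to T)
            from-first : (∃ λ j → j ≤ T × Occurs c (suc t) (f j) × (∀ l → l < j → ¬ Occurs c (suc t) (f l))) → ⊥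
            from-first (zero , _ , on , _) = not-on (subst (Occurs c (suc t)) start on)
            from-first (suc j , j< , (p₀ , p₀≤ , cp₀≡) , earlier) =
              no-attachment (within j (<⇒≤ j<)) (λ p p≤ eq → earlier j ≤-refl (p , p≤ , eq)) p₀≤
                            (subst (Adj (f j)) (sym cp₀≡) (walk j j<))

        isOddCycle : IsOddCycle G B
        isOddCycle with positive-double {s = s} odd
        ... | k , t≡ = k , c ∘ toℕ , c-injective , (λ i → ⊆B _ (bound i)) , surjective , λ i j → mk⇔ (to i j) (from i j)
          where
          open IsInducedCycle induced
          m = 3 + 2 * k
          m≡ : m ≡ suc (suc t)
          m≡ = trans (3+2k≡ k) (cong suc (sym t≡))
          bound : (i : Fin m) → toℕ i ≤ suc t
          bound i = ≤-pred (subst (toℕ i <_) m≡ (toℕ<n i))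
          c-injective : ∀ i j → c (toℕ i) ≡ c (toℕ j) → i ≡ j
          c-injective i j e = toℕ-injective (injective _ _ (bound i) (bound j) e)
          surjective : ∀ v → v ∈ B → ∃ λ i → c (toℕ i) ≡ v
          surjective v v∈ with covers v∈
          ... | l , l≤ , cl≡v = fromℕ< l< , trans (cong c (toℕ-fromℕ< l<)) cl≡v
            where l< = subst (l <_) (sym m≡) (s≤s l≤)
          next≡ : ∀ a → next (suc t) a ≡ suc a % m
          next≡ a = next-% a (sym m≡)
          to : ∀ i j → Adj (c (toℕ i)) (c (toℕ j)) → toℕ j ≡ suc (toℕ i) % m ⊎ toℕ i ≡ suc (toℕ j) % m
          to i j e with chordless _ _ (bound i) (bound j) e
          ... | inj₁ e' = inj₁ (trans e' (next≡ (toℕ i)))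
          ... | inj₂ e' = inj₂ (trans e' (next≡ (toℕ j)))
          from : ∀ i j → toℕ j ≡ suc (toℕ i) % m ⊎ toℕ i ≡ suc (toℕ j) % m → Adj (c (toℕ i)) (c (toℕ j))
          from i j (inj₁ e) = subst (Adj (c (toℕ i)) ∘ c) (trans (next≡ (toℕ i)) (sym e)) (adjacent _ (bound i))
          from i j (inj₂ e) = Adj-sym (subst (Adj (c (toℕ j)) ∘ c) (trans (next≡ (toℕ j)) (sym e)) (adjacent _ (bound j)))

      biconnected-complete-or-odd-cycle : IsComplete G B ⊎ IsOddCycle G B
      biconnected-complete-or-odd-cycle
        with any? (λ u → any? (λ v → (u ∈? B) ×-dec (v ∈? B) ×-dec ¬? (u ≟ᶠ v) ×-dec ¬? (adj? u v)))
      ... | yes (u , v , u∈ , v∈ , u≢v , u≁v) =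
        let (x , w , y , x∈ , w∈ , y∈ , x~w , w~y , x≁y , x≢y) = induced-P₃ u∈ v∈ u≢v u≁v
        in inj₂ (isOddCycle (long-odd-cycle x∈ w∈ y∈ x~w w~y x≁y x≢y))
      ... | no none = inj₁ λ u v u∈ v∈ u≢v → decidable-stable (adj? u v) λ u≁v → none (u , v , u∈ , v∈ , u≢v , u≁v)

theorem5 : (n : ℕ) (G : Graph n) → HereditarilyGeodetic G →
    (B : Subset n) → IsBlock G B → IsComplete G B ⊎ IsOddCycle G B
theorem5 n G hg B (biconnected , _) = biconnected-complete-or-odd-cycle G hg biconnected
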